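{- Let $m\ge 3$ be odd and let $W_m=C_m\vee O_1$ be the wheel with rim cycle $C_m$. If $e$ is an edge of $W_m$ with $e\notin E(C_m)$, then $\chi_{la}(W_m-e)=3$ for $m\in\{3,5,7\}$ and $\chi_{la}(W_m-e)=4$ for $m\ge 9$. If $e\in E(C_m)$, then $3\le\chi_{la}(W_m-e)\le 4$.
   Context: The wheel $W_m=C_m\vee O_1$ consists of a cycle $C_m$ (the rim) and one additional vertex adjacent to every vertex of the cycle. For a graph $G=(V,E)$, a local antimagic labeling is a bijection $f:E\to\{1,\dots,|E|\}$ such that, with $f^+(u)=\sum_{e\ni u} f(e)$, adjacent vertices receive distinct values of $f^+$; $c(f)$ is the number of distinct values of $f^+$ and $\chi_{la}(G)=\min c(f)$ over all local antimagic labelings. $G-e$ is $G$ with edge $e$ deleted. -}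

module Defs where

open import Data.Nat using (ℕ; zero; suc; _+_; _≤_; _≡ᵇ_; _%_; _∸_)
open import Data.Nat.ListAction using (sum)
open import Data.Nat.Properties using (_≟_)
open import Data.Bool using (Bool; if_then_else_; _∨_)
open import Data.Fin using (Fin; toℕ)
open import Data.List using (List; []; _∷_; _++_; map; length; lookup; upTo; allFin; deduplicate; removeAt)
open import Data.Product using (_×_; _,_; ∃-syntax; proj₁; proj₂)
open import Data.List.Membership.Propositional using (_∈_)
open import Function.Bundles using (_⤖_; Bijection)
open import Relation.Binary.PropositionalEquality using (_≡_; _≢_)

-- A finite graph: vertices 0, …, order-1; edges listed as (unordered) pairs of vertices.
record Graph : Set where
  constructor mkGraph
  field
    order : ℕ
    edges : List (ℕ × ℕ)
open Graph public

size : Graph → ℕ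
size G = length (edges G)

-- An edge labeling by a bijection E → {1,…,|E|}: edge number i gets label 1 + toℕ (to f i).
Labeling : Graph → Set
Labeling G = Fin (size G) ⤖ Fin (size G)

label : (G : Graph) → Labeling G → Fin (size G) → ℕ
label G f i = suc (toℕ (Bijection.to f i))

incident : ℕ → ℕ × ℕ → Bool
incident u (a , b) = (u ≡ᵇ a) ∨ (u ≡ᵇ b)

fplus : (G : Graph) → Labeling G → ℕ → ℕ
fplus G f u = sum (map (λ i → if incident u (lookup (edges G) i) then label G f i else 0)
                       (allFin (size G)))

IsLocalAntimagic : (G : Graph) → Labeling G → Set
IsLocalAntimagic G f = (i : Fin (size G)) →
  fplus G f (proj₁ (lookup (edges G) i)) ≢ fplus G f (proj₂ (lookup (edges G) i))

colours : (G : Graph) → Labeling G → ℕ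
colours G f = length (deduplicate _≟_ (map (fplus G f) (upTo (order G))))

ChiLaIs : Graph → ℕ → Set
ChiLaIs G k = (∃[ f ] (IsLocalAntimagic G f × colours G f ≡ k))
            × ((f : Labeling G) → IsLocalAntimagic G f → k ≤ colours G f)

ChiLaBetween : Graph → ℕ → ℕ → Set
ChiLaBetween G a b = (∃[ f ] (IsLocalAntimagic G f × colours G f ≤ b))
                   × ((f : Labeling G) → IsLocalAntimagic G f → a ≤ colours G f)

-- (suc (m ∸ 1) = m for m ≥ 1; written so that % needs no NonZero argument)
-- Wheel W_m: rim vertices 0,…,m-1 (cycle i — (i+1 mod m)), hub vertex m.
rimEdges : ℕ → List (ℕ × ℕ)
rimEdges m = map (λ i → (i , suc i % suc (m ∸ 1))) (upTo m)

spokeEdges : ℕ → List (ℕ × ℕ)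
spokeEdges m = map (λ i → (i , m)) (upTo m)

wheelEdges : ℕ → List (ℕ × ℕ)
wheelEdges m = rimEdges m ++ spokeEdges m

wheel : ℕ → Graph
wheel m = mkGraph (suc m) (wheelEdges m)

-- W_m − e, where e is given by its position in the edge list of W_m
wheelMinus : (m : ℕ) → Fin (length (wheelEdges m)) → Graph
wheelMinus m e = mkGraph (suc m) (removeAt (wheelEdges m) e)

IsRimEdge : (m : ℕ) → Fin (length (wheelEdges m)) → Set
IsRimEdge m e = lookup (wheelEdges m) e ∈ rimEdges m

module Submission where

open import Defs
open import Data.Nat using (ℕ; _≤_; _<_; suc; _*_)
open import Data.Fin using (Fin)
open import Data.List using (length)
open import Data.Product using (_×_; ∃-syntax)
open import Relation.Binary.PropositionalEquality using (_≡_)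
open import Relation.Nullary using (¬_)

open import Data.Nat using (zero; _+_; _∸_; z≤n; s≤s; pred; _≡ᵇ_; _<ᵇ_; _%_)
open import Data.Nat.Properties
open import Data.Nat.DivMod using (m<n⇒m%n≡m; n%n≡0; m%n<n)
open import Data.Nat.ListAction using (sum)
open import Data.Nat.ListAction.Properties using (sum-++; sum-↭)
open import Data.Nat.Tactic.RingSolver using (solve-∀)
open import Data.Bool using (Bool; true; false; if_then_else_; _∨_; T)
open import Data.Bool.Properties using (∨-zeroʳ; ∨-identityʳ)
open import Data.Unit using (tt)
open import Data.Empty using (⊥; ⊥-elim)
open import Data.Product using (_,_; proj₁; proj₂)
open import Data.Sum using (_⊎_; inj₁; inj₂)
open import Data.Fin using (toℕ; fromℕ<; punchOut) renaming (zero to fzero; suc to fsuc)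
open import Data.Fin.Properties using (toℕ-fromℕ<; toℕ-injective; toℕ<n; punchOut-injective; injective⇒≤; any?)
  renaming (_≟_ to _≟ᶠ_)
open import Data.List using (List; []; _∷_; _++_; map; lookup; upTo; applyUpTo; allFin; removeAt; [_])
open import Data.List.Properties
  using (map-tabulate; tabulate-lookup; map-cong; map-applyUpTo; map-++; map-∘; length-map; length-++; length-applyUpTo; length-removeAt)
open import Data.List.Relation.Unary.All as All using (All; []; _∷_; all?)
import Data.List.Relation.Unary.All.Properties as AllP
open import Data.List.Relation.Unary.AllPairs using ([]; _∷_)
open import Data.List.Relation.Unary.Any using (here; there; index)
open import Data.List.Relation.Unary.Any.Properties using (lookup-index)
open import Data.List.Relation.Unary.Unique.Propositional using (Unique)
import Data.List.Relation.Unary.Unique.Propositional.Properties as Unique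
open import Data.List.Relation.Unary.Unique.DecPropositional.Properties _≟_ using (deduplicate-!)
open import Data.List.Membership.Propositional using (_∈_)
open import Data.List.Membership.Propositional.Properties
  using (∈-map⁺; ∈-map⁻; ∈-++⁻; ∈-++⁺ˡ; ∈-++⁺ʳ; ∈-∃++; ∈-applyUpTo⁻; ∈-upTo⁺; ∈-upTo⁻; ∈-lookup; ∈-deduplicate⁺; ∈-deduplicate⁻)
open import Data.List.Membership.DecPropositional _≟_ using (_∈?_)
open import Data.List.Relation.Unary.Unique.DecPropositional _≟_ using (unique?)
open import Data.List.Relation.Binary.Permutation.Propositional using (_↭_; ↭-refl; ↭-sym; ↭-trans; prep; swap; ↭⇒↭ₛ)
import Data.List.Relation.Binary.Permutation.Propositional as Perm
open import Data.List.Relation.Binary.Permutation.Propositional.Properties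
  using (All-resp-↭; ∈-resp-↭; shift; ↭-length; drop-∷; ++-comm; ++⁺; map⁺)
import Data.List.Relation.Binary.Permutation.Setoid.Properties as SetoidPerm
open import Function using (_∘_; id; const)
open import Function.Bundles using (Bijection; mk⤖)
open import Relation.Binary.PropositionalEquality using (_≢_; refl; sym; trans; cong; cong₂; subst; subst₂; setoid; module ≡-Reasoning)
open import Relation.Binary.Definitions using (tri<; tri≈; tri>)
open import Relation.Nullary using (yes; no; ¬?)
open import Relation.Nullary.Decidable using (True; toWitness; _×-dec_)

-- Let m = 2k + 1 ≥ 3 and let W_m have rim vertices 0, …, m − 1 and hub m.
-- Upper bounds come from explicit labelings.  Rotations of the
-- rim are automorphisms of W_m, so it suffices to label W_m minus the spoke (0, m) or minus
-- the rim edge (0, 1) (Wheel.transport, minus-spoke, minus-rim).  For these two graphs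
-- SpokeConstruction and RimConstruction give four-colour labelings for all k, computing the
-- vertex sums R w + R (w − 1) + S w from the rim labels R and spoke labels S; for m = 3, 5, 7
-- three-colour labelings of W_m − spoke are checked by evaluation (Tabulated).
-- Lower bounds: a triangle surviving in W_m − e needs three colours.  If a spoke (v, m) is
-- removed and only three colours occur, either f⁺(v) = f⁺(m), impossible for m ≥ 9 since the
-- hub sums m − 1 distinct labels while v sums only two, or no rim vertex has the hub colour,
-- so the odd rim cycle would be properly coloured with two colours (LowerBounds).

≡ᵇ-refl : ∀ n → (n ≡ᵇ n) ≡ true
≡ᵇ-refl zero = refl
≡ᵇ-refl (suc n) = ≡ᵇ-refl n

≡ᵇ-sound : ∀ m n → (m ≡ᵇ n) ≡ true → m ≡ n
≡ᵇ-sound m n p = ≡ᵇ⇒≡ m n (subst T (sym p) tt)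

≡ᵇ-false : ∀ {m n} → m ≢ n → (m ≡ᵇ n) ≡ false
≡ᵇ-false {m} {n} m≢n with m ≡ᵇ n in eq
... | false = refl
... | true = ⊥-elim (m≢n (≡ᵇ-sound m n eq))

<ᵇ-true : ∀ {m n} → m < n → (m <ᵇ n) ≡ true
<ᵇ-true {m} {n} m<n with m <ᵇ n | <⇒<ᵇ m<n
... | true | _ = refl

<ᵇ-false : ∀ {m n} → n ≤ m → (m <ᵇ n) ≡ false
<ᵇ-false {m} {n} n≤m with m <ᵇ n in eq
... | false = refl
... | true = ⊥-elim (<⇒≱ (<ᵇ⇒< m n (subst T (sym eq) tt)) n≤m)

if-true : ∀ {A : Set} {b} {x y : A} → b ≡ true → (if b then x else y) ≡ x
if-true refl = refl

if-false : ∀ {A : Set} {b} {x y : A} → b ≡ false → (if b then x else y) ≡ y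
if-false refl = refl

sumTo : (ℕ → ℕ) → ℕ → ℕ
sumTo f n = sum (applyUpTo f n)

applyUpTo-cong : ∀ {A : Set} (f g : ℕ → A) n → (∀ i → i < n → f i ≡ g i) → applyUpTo f n ≡ applyUpTo g n
applyUpTo-cong f g zero h = refl
applyUpTo-cong f g (suc n) h =
  cong₂ _∷_ (h 0 (s≤s z≤n)) (applyUpTo-cong (f ∘ suc) (g ∘ suc) n (λ i i<n → h (suc i) (s≤s i<n)))

sumTo-cong : ∀ f g n → (∀ i → i < n → f i ≡ g i) → sumTo f n ≡ sumTo g n
sumTo-cong f g n h = cong sum (applyUpTo-cong f g n h)

sumTo-zero : ∀ f n → (∀ i → i < n → f i ≡ 0) → sumTo f n ≡ 0
sumTo-zero f n h = trans (sumTo-cong f (λ _ → 0) n h) (zeros n)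
  where
  zeros : ∀ n → sumTo (λ _ → 0) n ≡ 0
  zeros zero = refl
  zeros (suc n) = zeros n

sumTo-single : ∀ f n a → a < n → (∀ i → i < n → i ≢ a → f i ≡ 0) → sumTo f n ≡ f a
sumTo-single f (suc n) zero _ h =
  trans (cong (f 0 +_) (sumTo-zero (f ∘ suc) n (λ i i<n → h (suc i) (s≤s i<n) (λ ())))) (+-identityʳ (f 0))
sumTo-single f (suc n) (suc a) (s≤s a<n) h =
  trans (cong (_+ sumTo (f ∘ suc) n) (h 0 (s≤s z≤n) (λ ())))
        (sumTo-single (f ∘ suc) n a a<n (λ i i<n i≢a → h (suc i) (s≤s i<n) (i≢a ∘ suc-injective)))

sumTo-+ : ∀ f g n → sumTo (λ i → f i + g i) n ≡ sumTo f n + sumTo g n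
sumTo-+ f g zero = refl
sumTo-+ f g (suc n) =
  trans (cong (f 0 + g 0 +_) (sumTo-+ (f ∘ suc) (g ∘ suc) n)) (interchange (f 0) (g 0) (sumTo (f ∘ suc) n) (sumTo (g ∘ suc) n))
  where
  interchange : ∀ a b c d → a + b + (c + d) ≡ a + c + (b + d)
  interchange = solve-∀

sumTo-lower : ∀ f n lo → (∀ i → i < n → lo ≤ f i) → n * lo ≤ sumTo f n
sumTo-lower f zero lo h = z≤n
sumTo-lower f (suc n) lo h = +-mono-≤ (h 0 (s≤s z≤n)) (sumTo-lower (f ∘ suc) n lo (λ i i<n → h (suc i) (s≤s i<n)))

applyUpTo-++ : ∀ {A : Set} (f : ℕ → A) a b → applyUpTo f (a + b) ≡ applyUpTo f a ++ applyUpTo (λ j → f (a + j)) b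
applyUpTo-++ f zero b = refl
applyUpTo-++ f (suc a) b = cong (f 0 ∷_) (applyUpTo-++ (f ∘ suc) a b)

Unique-resp-↭ : ∀ {A : Set} {xs ys : List A} → xs ↭ ys → Unique xs → Unique ys
Unique-resp-↭ {A} p = SetoidPerm.Unique-resp-↭ (setoid A) (↭⇒↭ₛ p)

unique-⊆-length : ∀ {A : Set} {xs ys : List A} → Unique xs → All (_∈ ys) xs → length xs ≤ length ys
unique-⊆-length [] [] = z≤n
unique-⊆-length {xs = x ∷ xs} (x∉xs ∷ u) (x∈ys ∷ xs⊆ys) with ∈-∃++ x∈ys
... | as , bs , refl =
  subst (suc (length xs) ≤_) (sym (length-middle as bs))
    (s≤s (unique-⊆-length u (All.zipWith (λ (x≢y , y∈) → delete-∈ as bs y∈ (x≢y ∘ sym)) (x∉xs , xs⊆ys))))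
  where
  length-middle : ∀ as bs → length (as ++ x ∷ bs) ≡ suc (length (as ++ bs))
  length-middle [] bs = refl
  length-middle (a ∷ as) bs = cong suc (length-middle as bs)
  delete-∈ : ∀ {y} as bs → y ∈ as ++ x ∷ bs → y ≢ x → y ∈ as ++ bs
  delete-∈ [] bs (here refl) y≢x = ⊥-elim (y≢x refl)
  delete-∈ [] bs (there p) _ = p
  delete-∈ (a ∷ as) bs (here refl) _ = here refl
  delete-∈ (a ∷ as) bs (there p) y≢x = there (delete-∈ as bs p y≢x)

lookup-injective : ∀ {A B : Set} (L : A → B) (xs : List A) → Unique (map L xs) →
                   (i j : Fin (length xs)) → L (lookup xs i) ≡ L (lookup xs j) → i ≡ j
lookup-injective L (x ∷ xs) u fzero fzero e = refl
lookup-injective L (x ∷ xs) (distinct ∷ _) fzero (fsuc j) e = ⊥-elim (All.lookup distinct (∈-map⁺ L (∈-lookup j)) e)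
lookup-injective L (x ∷ xs) (distinct ∷ _) (fsuc i) fzero e = ⊥-elim (All.lookup distinct (∈-map⁺ L (∈-lookup i)) (sym e))
lookup-injective L (x ∷ xs) (_ ∷ u) (fsuc i) (fsuc j) e = cong fsuc (lookup-injective L xs u i j e)

lookup-↭ : ∀ {A : Set} (xs : List A) (i : Fin (length xs)) → xs ↭ lookup xs i ∷ removeAt xs i
lookup-↭ (x ∷ xs) fzero = ↭-refl
lookup-↭ (x ∷ xs) (fsuc i) = ↭-trans (prep x (lookup-↭ xs i)) (swap x (lookup xs i) ↭-refl)

All-block : ∀ {A : Set} {P : A → Set} (h : ℕ → A) f k → (∀ i → i < k → P (h (f i))) → All P (map h (applyUpTo f k))
All-block {P = P} h f k P-block = All.tabulate λ x∈ →
  let (y , y∈ , x≡) = ∈-map⁻ h x∈ ; (i , i<k , y≡) = ∈-applyUpTo⁻ f y∈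
  in subst P (sym (trans x≡ (cong h y≡))) (P-block i i<k)

count : ∀ {A : Set} → (A → Bool) → List A → ℕ
count p [] = 0
count p (x ∷ xs) = if p x then suc (count p xs) else count p xs

select : ∀ {A B : Set} → (A → Bool) → (A → B) → List A → List B
select p g [] = []
select p g (x ∷ xs) = if p x then g x ∷ select p g xs else select p g xs

sum-select : ∀ {A : Set} (p : A → Bool) (g : A → ℕ) xs →
             sum (map (λ x → if p x then g x else 0) xs) ≡ sum (select p g xs)
sum-select p g [] = refl
sum-select p g (x ∷ xs) with p x
... | true = cong (g x +_) (sum-select p g xs)
... | false = sum-select p g xs

length-select : ∀ {A B : Set} (p : A → Bool) (g : A → B) xs → length (select p g xs) ≡ count p xs
length-select p g [] = refl
length-select p g (x ∷ xs) with p x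
... | true = cong suc (length-select p g xs)
... | false = length-select p g xs

All-select : ∀ {A B : Set} {Q : B → Set} (p : A → Bool) (g : A → B) xs →
             All (λ x → p x ≡ true → Q (g x)) xs → All Q (select p g xs)
All-select p g [] [] = []
All-select p g (x ∷ xs) (q ∷ qs) with p x
... | true = q refl ∷ All-select p g xs qs
... | false = All-select p g xs qs

Unique-select : ∀ {A B : Set} (p : A → Bool) (g : A → B) xs → (∀ {x y} → g x ≡ g y → x ≡ y) →
                Unique xs → Unique (select p g xs)
Unique-select p g [] g-inj [] = []
Unique-select p g (x ∷ xs) g-inj (x∉xs ∷ u) with p x
... | true = All-select p g xs (All.map (λ x≢y _ e → x≢y (g-inj e)) x∉xs) ∷ Unique-select p g xs g-inj u
... | false = Unique-select p g xs g-inj u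

count-++ : ∀ {A : Set} (p : A → Bool) xs ys → count p (xs ++ ys) ≡ count p xs + count p ys
count-++ p [] ys = refl
count-++ p (x ∷ xs) ys with p x
... | true = cong suc (count-++ p xs ys)
... | false = count-++ p xs ys

count-map : ∀ {A B : Set} (p : B → Bool) (f : A → B) xs → count p (map f xs) ≡ count (p ∘ f) xs
count-map p f [] = refl
count-map p f (x ∷ xs) with p (f x)
... | true = cong suc (count-map p f xs)
... | false = count-map p f xs

count-↭ : ∀ {A : Set} (p : A → Bool) {xs ys} → xs ↭ ys → count p xs ≡ count p ys
count-↭ p Perm.refl = refl
count-↭ p (Perm.prep x q) with p x
... | true = cong suc (count-↭ p q)
... | false = count-↭ p q
count-↭ p (Perm.swap x y q) with p x | p y
... | true | true = cong (suc ∘ suc) (count-↭ p q)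
... | true | false = cong suc (count-↭ p q)
... | false | true = cong suc (count-↭ p q)
... | false | false = count-↭ p q
count-↭ p (Perm.trans q r) = trans (count-↭ p q) (count-↭ p r)

count-all : ∀ {A : Set} (p : A → Bool) xs → All (λ x → p x ≡ true) xs → count p xs ≡ length xs
count-all p [] [] = refl
count-all p (x ∷ xs) (px ∷ pxs) rewrite px = cong suc (count-all p xs pxs)

count-mono : ∀ {A : Set} (p q : A → Bool) xs → (∀ x → p x ≡ true → q x ≡ true) → count p xs ≤ count q xs
count-mono p q [] h = z≤n
count-mono p q (x ∷ xs) h with p x in px | q x in qx
... | true | true = s≤s (count-mono p q xs h)
... | true | false with () ← trans (sym (h x px)) qx
... | false | true = m≤n⇒m≤1+n (count-mono p q xs h)
... | false | false = count-mono p q xs h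

count-∨ : ∀ {A : Set} (p q : A → Bool) xs → count (λ x → p x ∨ q x) xs ≤ count p xs + count q xs
count-∨ p q [] = z≤n
count-∨ p q (x ∷ xs) with p x | q x
... | true | true = s≤s (≤-trans (count-∨ p q xs) (+-monoʳ-≤ (count p xs) (n≤1+n (count q xs))))
... | true | false = s≤s (count-∨ p q xs)
... | false | true = ≤-trans (s≤s (count-∨ p q xs)) (≤-reflexive (sym (+-suc (count p xs) (count q xs))))
... | false | false = count-∨ p q xs

count-unique≤1 : ∀ {A : Set} (p : A → Bool) xs (c : A) → Unique xs → (∀ {x} → x ∈ xs → p x ≡ true → x ≡ c) → count p xs ≤ 1
count-unique≤1 p xs c u only-c =
  subst (_≤ 1) (length-select p id xs)
    (unique-⊆-length (Unique-select p id xs id u)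
      (All-select p id xs (All.tabulate (λ x∈ px → subst (_∈ [ c ]) (sym (only-c x∈ px)) (here refl)))))

Edge : Set
Edge = ℕ × ℕ

weightAt : (Edge → ℕ) → List Edge → ℕ → ℕ
weightAt L es u = sum (map (λ ed → if incident u ed then L ed else 0) es)

weightAt-++ : ∀ L xs ys u → weightAt L (xs ++ ys) u ≡ weightAt L xs u + weightAt L ys u
weightAt-++ L xs ys u = trans (cong sum (map-++ _ xs ys)) (sum-++ (map _ xs) (map _ ys))

weightAt-↭ : ∀ L {xs ys} u → xs ↭ ys → weightAt L xs u ≡ weightAt L ys u
weightAt-↭ L u p = sum-↭ (map⁺ _ p)

weightAt-∷-zero : ∀ L {e₀} R u → L e₀ ≡ 0 → weightAt L (e₀ ∷ R) u ≡ weightAt L R u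
weightAt-∷-zero L {e₀} R u Le₀≡0 with incident u e₀
... | true = cong (_+ weightAt L R u) Le₀≡0
... | false = refl

InRange : ℕ → ℕ → Set
InRange B x = 1 ≤ x × x ≤ B

injective⇒surjective : ∀ {n} (f : Fin n → Fin n) → (∀ {x y} → f x ≡ f y → x ≡ y) → ∀ y → ∃[ x ] f x ≡ y
injective⇒surjective {suc n} f f-inj y with any? (λ x → f x ≟ᶠ y)
... | yes hit = hit
... | no miss = ⊥-elim (1+n≰n (injective⇒≤ {f = squeeze} squeeze-inj))
  where
  y≢f : ∀ x → y ≢ f x
  y≢f x e = miss (x , sym e)
  squeeze : Fin (suc n) → Fin n
  squeeze x = punchOut (y≢f x)
  squeeze-inj : ∀ {x z} → squeeze x ≡ squeeze z → x ≡ z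
  squeeze-inj {x} {z} e = f-inj (punchOut-injective (y≢f x) (y≢f z) e)

module FromWeighting (G : Graph) (w : Fin (size G) → ℕ)
                     (w-inj : ∀ {i j} → w i ≡ w j → i ≡ j)
                     (w-range : ∀ i → InRange (size G) (w i)) where

  index-of : ∀ i → ∃[ k ] (suc (toℕ k) ≡ w i)
  index-of i with w i | w-range i
  ... | suc v | _ , v<N = fromℕ< v<N , cong suc (toℕ-fromℕ< v<N)

  to : Fin (size G) → Fin (size G)
  to i = proj₁ (index-of i)

  to-inj : ∀ {i j} → to i ≡ to j → i ≡ j
  to-inj {i} {j} e = w-inj (trans (sym (proj₂ (index-of i))) (trans (cong (suc ∘ toℕ) e) (proj₂ (index-of j))))

  labeling : Labeling G
  labeling = mk⤖ {to = to} (to-inj , λ y → let (x , p) = injective⇒surjective to to-inj y in x , λ { refl → p })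

  label-labeling : ∀ i → label G labeling i ≡ w i
  label-labeling i = proj₂ (index-of i)

fplus-weightAt : (G : Graph) (L : Edge → ℕ) (f : Labeling G) →
                 (∀ i → label G f i ≡ L (lookup (edges G) i)) → ∀ u → fplus G f u ≡ weightAt L (edges G) u
fplus-weightAt G L f f≡L u =
  cong sum (trans (map-cong (λ i → cong (λ z → if incident u (lookup (edges G) i) then z else 0) (f≡L i)) (allFin (size G)))
           (trans (map-tabulate id (term ∘ lookup (edges G)))
           (trans (sym (map-tabulate (lookup (edges G)) term)) (cong (map term) (tabulate-lookup (edges G))))))
  where
  term : Edge → ℕ
  term ed = if incident u ed then L ed else 0

module LabelingFacts (G : Graph) (f : Labeling G) where

  values : List ℕ
  values = map (fplus G f) (upTo (order G))

  value∈ : ∀ {u} → u < order G → fplus G f u ∈ values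
  value∈ u< = ∈-map⁺ (fplus G f) (∈-upTo⁺ u<)

  colours-≥ : ∀ ys → Unique ys → All (_∈ values) ys → length ys ≤ colours G f
  colours-≥ ys u ys⊆ = unique-⊆-length u (All.map (∈-deduplicate⁺ _≟_) ys⊆)

  colours-≤ : (vals : List ℕ) → (∀ u → u < order G → fplus G f u ∈ vals) → colours G f ≤ length vals
  colours-≤ vals covered = unique-⊆-length (deduplicate-! values) (All.tabulate (λ z∈ → in-vals (∈-deduplicate⁻ _≟_ values z∈)))
    where
    in-vals : ∀ {z} → z ∈ values → z ∈ vals
    in-vals z∈ with ∈-map⁻ (fplus G f) z∈
    ... | u , u∈ , refl with ∈-applyUpTo⁻ id u∈
    ...   | _ , u< , refl = covered u u<

  label-injective : ∀ {i j} → label G f i ≡ label G f j → i ≡ j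
  label-injective e = Bijection.injective f (toℕ-injective (suc-injective e))

  incidentLabels : ℕ → List ℕ
  incidentLabels u = select (λ i → incident u (lookup (edges G) i)) (label G f) (allFin (size G))

  fplus≡sum : ∀ u → fplus G f u ≡ sum (incidentLabels u)
  fplus≡sum u = sum-select (λ i → incident u (lookup (edges G) i)) (label G f) (allFin (size G))

  length-incidentLabels : ∀ u → length (incidentLabels u) ≡ count (incident u) (edges G)
  length-incidentLabels u =
    trans (length-select _ _ (allFin (size G)))
          (trans (sym (count-map (incident u) (lookup (edges G)) (allFin (size G))))
                 (cong (count (incident u)) (trans (map-tabulate id (lookup (edges G))) (tabulate-lookup (edges G)))))

  incidentLabels-unique : ∀ u → Unique (incidentLabels u)
  incidentLabels-unique u = Unique-select _ (label G f) (allFin (size G)) label-injective (Unique.allFin⁺ (size G))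

  incidentLabels-inRange : ∀ u → All (InRange (size G)) (incidentLabels u)
  incidentLabels-inRange u =
    All-select _ (label G f) (allFin (size G)) (All.tabulate (λ {i} _ _ → s≤s z≤n , toℕ<n (Bijection.to f i)))

  adjacent-distinct : IsLocalAntimagic G f → ∀ {ed} → ed ∈ edges G → fplus G f (proj₁ ed) ≢ fplus G f (proj₂ ed)
  adjacent-distinct la ed∈ = subst (λ ed → fplus G f (proj₁ ed) ≢ fplus G f (proj₂ ed)) (sym (lookup-index ed∈)) (la (index ed∈))

record GoodWeighting (n : ℕ) (R : List Edge) (vals : List ℕ) : Set where
  field
    L : Edge → ℕ
    distinct : Unique (map L R)
    in-range : All (InRange (length R)) (map L R)
    proper : All (λ ed → weightAt L R (proj₁ ed) ≢ weightAt L R (proj₂ ed)) R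
    covered : ∀ w → w < n → weightAt L R w ∈ vals

weighting⇒labeling : (G : Graph) (vals : List ℕ) → GoodWeighting (order G) (edges G) vals →
                     ∃[ f ] (IsLocalAntimagic G f × colours G f ≤ length vals)
weighting⇒labeling G vals gw = labeling , antimagic , LabelingFacts.colours-≤ G labeling vals covered-f
  where
  open GoodWeighting gw
  w : Fin (size G) → ℕ
  w i = L (lookup (edges G) i)
  open FromWeighting G w (λ {i} {j} → lookup-injective L (edges G) distinct i j)
                         (λ i → All.lookup in-range (∈-map⁺ L (∈-lookup i)))
  fplus≡ : ∀ u → fplus G labeling u ≡ weightAt L (edges G) u
  fplus≡ = fplus-weightAt G L labeling label-labeling
  antimagic : IsLocalAntimagic G labeling
  antimagic i rewrite fplus≡ (proj₁ (lookup (edges G) i)) | fplus≡ (proj₂ (lookup (edges G) i)) =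
    All.lookup proper (∈-lookup i)
  covered-f : ∀ u → u < order G → fplus G labeling u ∈ vals
  covered-f u u< = subst (_∈ vals) (sym (fplus≡ u)) (covered u u<)

module Wheel (m' : ℕ) where

  m : ℕ
  m = suc m'

  next : ℕ → ℕ
  next i = suc i % m

  rimEdge : ℕ → Edge
  rimEdge i = (i , next i)

  spoke : ℕ → Edge
  spoke i = (i , m)

  W : List Edge
  W = wheelEdges m

  next<m : ∀ i → next i < m
  next<m i = m%n<n (suc i) m

  next-step : ∀ {i} → suc i < m → next i ≡ suc i
  next-step = m<n⇒m%n≡m

  next-last : next m' ≡ 0
  next-last = n%n≡0 m

  data NextView (i : ℕ) : Set where
    step : suc i < m → next i ≡ suc i → NextView i
    wrap : suc i ≡ m → next i ≡ 0 → NextView i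

  next-view : ∀ i → i < m → NextView i
  next-view i (s≤s i≤m') with i ≟ m'
  ... | yes refl = wrap refl next-last
  ... | no i≢m' = step (s≤s (≤∧≢⇒< i≤m' i≢m')) (next-step (s≤s (≤∧≢⇒< i≤m' i≢m')))

  rimEdge≢spoke : ∀ i x → rimEdge i ≢ spoke x
  rimEdge≢spoke i x e = <-irrefl (cong proj₂ e) (next<m i)

  rimEdge∈W : ∀ {i} → i < m → rimEdge i ∈ W
  rimEdge∈W i< = ∈-++⁺ˡ (∈-map⁺ rimEdge (∈-upTo⁺ i<))

  spoke∈W : ∀ {i} → i < m → spoke i ∈ W
  spoke∈W i< = ∈-++⁺ʳ (map rimEdge (upTo m)) (∈-map⁺ spoke (∈-upTo⁺ i<))

  edge-view : ∀ {ed} → ed ∈ W → (∃[ i ] (i < m × ed ≡ rimEdge i)) ⊎ (∃[ i ] (i < m × ed ≡ spoke i))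
  edge-view ed∈ with ∈-++⁻ (map rimEdge (upTo m)) ed∈
  ... | inj₁ p with ∈-map⁻ rimEdge p
  ...   | i , i∈ , refl with ∈-applyUpTo⁻ id i∈
  ...     | _ , i< , refl = inj₁ (i , i< , refl)
  edge-view ed∈ | inj₂ p with ∈-map⁻ spoke p
  ...   | i , i∈ , refl with ∈-applyUpTo⁻ id i∈
  ...     | _ , i< , refl = inj₂ (i , i< , refl)

  VerticesBounded : Edge → Set
  VerticesBounded (a , b) = a ≤ m × b ≤ m

  W-bounded : All VerticesBounded W
  W-bounded = All.tabulate λ ed∈ → bounded (edge-view ed∈)
    where
    bounded : ∀ {ed} → (∃[ i ] (i < m × ed ≡ rimEdge i)) ⊎ (∃[ i ] (i < m × ed ≡ spoke i)) → VerticesBounded ed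
    bounded (inj₁ (i , i< , refl)) = <⇒≤ i< , <⇒≤ (next<m i)
    bounded (inj₂ (i , i< , refl)) = <⇒≤ i< , ≤-refl

  spoke-position : (e : Fin (length W)) → ¬ IsRimEdge m e → ∃[ v ] (v < m × lookup W e ≡ spoke v)
  spoke-position e not-rim with edge-view (∈-lookup e)
  ... | inj₁ (i , i< , eq) = ⊥-elim (not-rim (subst (_∈ map rimEdge (upTo m)) (sym eq) (∈-map⁺ rimEdge (∈-upTo⁺ i<))))
  ... | inj₂ spoke-v = spoke-v

  rim-position : (e : Fin (length W)) → IsRimEdge m e → ∃[ j ] (j < m × lookup W e ≡ rimEdge j)
  rim-position e is-rim with ∈-map⁻ rimEdge is-rim
  ... | j , j∈ , eq with ∈-applyUpTo⁻ id j∈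
  ...   | _ , j< , refl = j , j< , eq

  -- rot c d turns the rim so that vertex c goes to 0 (for c + d = m) and fixes the hub.
  rot : ℕ → ℕ → ℕ → ℕ
  rot c d u = if u <ᵇ c then u + d else (if u <ᵇ m then u ∸ c else u)

  rot-low : ∀ c d {u} → u < c → rot c d u ≡ u + d
  rot-low c d u<c rewrite <ᵇ-true u<c = refl

  rot-high : ∀ c d {j} → c + d ≡ m → j < d → rot c d (c + j) ≡ j
  rot-high c d {j} c+d≡m j<d
    rewrite <ᵇ-false {c + j} {c} (m≤m+n c j) | <ᵇ-true (subst (c + j <_) c+d≡m (+-monoʳ-< c j<d)) = m+n∸m≡n c j

  rot-hub : ∀ c d → c + d ≡ m → rot c d m ≡ m
  rot-hub c d c+d≡m rewrite <ᵇ-false {m} {c} (subst (c ≤_) c+d≡m (m≤m+n c d)) | <ᵇ-false {m} {m} ≤-refl = refl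

  data RotView (c d a : ℕ) : Set where
    before : a < c → RotView c d a
    after : ∀ j → a ≡ c + j → j < d → RotView c d a
    centre : a ≡ m → RotView c d a

  rot-view : ∀ c d → c + d ≡ m → ∀ a → a ≤ m → RotView c d a
  rot-view c d c+d≡m a a≤m with a <? c | a ≟ m
  ... | yes a<c | _ = before a<c
  ... | no _ | yes a≡m = centre a≡m
  ... | no a≮c | no a≢m = after (a ∸ c) (sym (m+[n∸m]≡n c≤a))
                               (+-cancelˡ-< c _ _ (subst₂ _<_ (sym (m+[n∸m]≡n c≤a)) (sym c+d≡m) (≤∧≢⇒< a≤m a≢m)))
    where
    c≤a : c ≤ a
    c≤a = ≮⇒≥ a≮c

  rot-bounded : ∀ c d → c + d ≡ m → ∀ a → a ≤ m → rot c d a ≤ m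
  rot-bounded c d c+d≡m a a≤m with rot-view c d c+d≡m a a≤m
  ... | before a<c = subst (_≤ m) (sym (rot-low c d a<c)) (subst (a + d ≤_) c+d≡m (+-monoˡ-≤ d (<⇒≤ a<c)))
  ... | after j refl j<d = subst (_≤ m) (sym (rot-high c d c+d≡m j<d)) (≤-trans (<⇒≤ j<d) (subst (d ≤_) c+d≡m (m≤n+m d c)))
  ... | centre refl = ≤-reflexive (rot-hub c d c+d≡m)

  rot-inverse : ∀ c d → c + d ≡ m → ∀ a → a ≤ m → rot d c (rot c d a) ≡ a
  rot-inverse c d c+d≡m a a≤m with rot-view c d c+d≡m a a≤m
  ... | before a<c rewrite rot-low c d a<c | +-comm a d = rot-high d c d+c≡m a<c
    where
    d+c≡m : d + c ≡ m
    d+c≡m = trans (+-comm d c) c+d≡m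
  ... | after j refl j<d rewrite rot-high c d c+d≡m j<d = trans (rot-low d c j<d) (+-comm j c)
  ... | centre refl rewrite rot-hub c d c+d≡m = rot-hub d c (trans (+-comm d c) c+d≡m)

  module Rotation (c : ℕ) (c<m : c < m) where

    d : ℕ
    d = m ∸ c

    c+d≡m : c + d ≡ m
    c+d≡m = m+[n∸m]≡n (<⇒≤ c<m)

    0<d : 0 < d
    0<d = m<n⇒0<n∸m c<m

    ρ : ℕ → ℕ
    ρ = rot c d

    ρ-edge : Edge → Edge
    ρ-edge (a , b) = (ρ a , ρ b)

    ρ-c : ρ c ≡ 0
    ρ-c = trans (cong ρ (sym (+-identityʳ c))) (rot-high c d c+d≡m 0<d)

    ρ-hub : ρ m ≡ m
    ρ-hub = rot-hub c d c+d≡m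

    ρ-injective : ∀ {a b} → a ≤ m → b ≤ m → ρ a ≡ ρ b → a ≡ b
    ρ-injective {a} {b} a≤m b≤m e =
      trans (sym (rot-inverse c d c+d≡m a a≤m)) (trans (cong (rot d c) e) (rot-inverse c d c+d≡m b b≤m))

    ≡ᵇ-ρ : ∀ {a b} → a ≤ m → b ≤ m → (a ≡ᵇ b) ≡ (ρ a ≡ᵇ ρ b)
    ≡ᵇ-ρ {a} {b} a≤m b≤m with a ≟ b
    ... | yes refl = trans (≡ᵇ-refl a) (sym (≡ᵇ-refl (ρ a)))
    ... | no a≢b = trans (≡ᵇ-false a≢b) (sym (≡ᵇ-false (a≢b ∘ ρ-injective a≤m b≤m)))

    incident-ρ : ∀ {u} ed → u ≤ m → VerticesBounded ed → incident u ed ≡ incident (ρ u) (ρ-edge ed)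
    incident-ρ (a , b) u≤m (a≤m , b≤m) = cong₂ _∨_ (≡ᵇ-ρ u≤m a≤m) (≡ᵇ-ρ u≤m b≤m)

    wrap-gap : ∀ {j} → suc (c + j) ≡ m → suc j ≡ d
    wrap-gap {j} c+sj≡m = +-cancelˡ-≡ c _ _ (trans (+-suc c j) (trans c+sj≡m (sym c+d≡m)))

    ρ-next : ∀ i → i < m → ρ (next i) ≡ next (ρ i)
    ρ-next i i<m with rot-view c d c+d≡m i (<⇒≤ i<m) | next-view i i<m
    ... | centre i≡m | _ = ⊥-elim (<-irrefl i≡m i<m)
    ... | before i<c | wrap si≡m _ = ⊥-elim (<-irrefl si≡m (≤-<-trans i<c c<m))
    ... | before i<c | step _ ni rewrite ni | rot-low c d i<c with suc i <? c
    ...   | yes si<c = trans (rot-low c d si<c) (sym (next-step (subst (suc i + d <_) c+d≡m (+-monoˡ-< d si<c))))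
    ...   | no si≮c = trans (cong ρ si≡c) (trans ρ-c (sym (trans (cong next (suc-injective i+d≡m')) next-last)))
      where
      si≡c : suc i ≡ c
      si≡c = ≤-antisym i<c (≮⇒≥ si≮c)
      i+d≡m' : suc (i + d) ≡ suc m'
      i+d≡m' = trans (cong (_+ d) si≡c) c+d≡m
    ρ-next i i<m | after j refl j<d | step c+sj<m ni rewrite ni | rot-high c d c+d≡m j<d =
      trans (cong ρ (sym (+-suc c j))) (trans (rot-high c d c+d≡m sj<d) (sym (next-step (<-≤-trans sj<d d≤m))))
      where
      sj<d : suc j < d
      sj<d = +-cancelˡ-< c _ _ (subst₂ _<_ (sym (+-suc c j)) (sym c+d≡m) c+sj<m)
      d≤m : d ≤ m
      d≤m = subst (d ≤_) c+d≡m (m≤n+m d c)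
    ρ-next i i<m | after j refl j<d | wrap c+sj≡m ni rewrite ni | rot-high c d c+d≡m j<d with c ≟ 0
    ... | yes c≡0 = trans (cong ρ (sym c≡0)) (trans ρ-c (sym (trans (cong next (suc-injective sj≡m)) next-last)))
      where
      sj≡m : suc j ≡ m
      sj≡m = trans (wrap-gap c+sj≡m) (trans (cong (_+ d) (sym c≡0)) c+d≡m)
    ... | no c≢0 = trans (rot-low c d (n≢0⇒n>0 c≢0)) (sym (trans (next-step (subst (_< m) (sym (wrap-gap c+sj≡m)) d<m)) (wrap-gap c+sj≡m)))
      where
      d<m : d < m
      d<m = subst (d <_) c+d≡m (+-monoˡ-< d (n≢0⇒n>0 c≢0))

    -- ρ permutes the rim vertices: it maps 0, …, c-1 to d, …, m-1 and c, …, m-1 to 0, …, d-1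
    ρ-permutes-rim : map ρ (upTo m) ↭ upTo m
    ρ-permutes-rim = subst (λ k → map ρ (upTo k) ↭ upTo k) c+d≡m
                       (subst₂ _↭_ (sym images) blocks-swapped (++-comm (applyUpTo (_+ d) c) (upTo d)))
      where
      images : map ρ (upTo (c + d)) ≡ applyUpTo (_+ d) c ++ upTo d
      images = trans (cong (map ρ) (applyUpTo-++ id c d))
               (trans (map-++ ρ (upTo c) (applyUpTo (c +_) d))
               (cong₂ _++_ (trans (map-applyUpTo id ρ c) (applyUpTo-cong ρ (_+ d) c (λ i i<c → rot-low c d i<c)))
                           (trans (map-applyUpTo (c +_) ρ d) (applyUpTo-cong (ρ ∘ (c +_)) id d (λ j j<d → rot-high c d c+d≡m j<d)))))
      blocks-swapped : upTo d ++ applyUpTo (_+ d) c ≡ upTo (c + d)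
      blocks-swapped = trans (cong (upTo d ++_) (applyUpTo-cong (_+ d) (d +_) c (λ i _ → +-comm i d)))
                       (trans (sym (applyUpTo-++ id d c)) (cong upTo (+-comm d c)))

    ρ-permutes-edges : map ρ-edge W ↭ W
    ρ-permutes-edges = subst (_↭ W) (sym (map-++ ρ-edge (map rimEdge (upTo m)) (map spoke (upTo m))))
                         (++⁺ (part rimEdge (λ i i<m → cong (ρ i ,_) (ρ-next i i<m)))
                              (part spoke (λ _ _ → cong (ρ _ ,_) ρ-hub)))
      where
      part : (h : ℕ → Edge) → (∀ i → i < m → ρ-edge (h i) ≡ h (ρ i)) → map ρ-edge (map h (upTo m)) ↭ map h (upTo m)
      part h equivariant = subst (_↭ map h (upTo m)) (sym moved) (map⁺ h ρ-permutes-rim)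
        where
        moved : map ρ-edge (map h (upTo m)) ≡ map h (map ρ (upTo m))
        moved = trans (sym (map-∘ (upTo m)))
                (trans (trans (map-applyUpTo id (ρ-edge ∘ h) m) (applyUpTo-cong (ρ-edge ∘ h) (h ∘ ρ) m equivariant))
                       (trans (sym (map-applyUpTo id (h ∘ ρ) m)) (map-∘ (upTo m))))

    transport : (e : Fin (length W)) {e₀ : Edge} {R₀ : List Edge} {vals : List ℕ} →
                ρ-edge (lookup W e) ≡ e₀ → W ↭ e₀ ∷ R₀ →
                GoodWeighting (suc m) R₀ vals → GoodWeighting (suc m) (removeAt W e) vals
    transport e {e₀} {R₀} {vals} ρe≡e₀ W↭ gw = record
      { L = L ∘ ρ-edge
      ; distinct = Unique-resp-↭ (↭-sym labels-perm) distinct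
      ; in-range = subst (λ n → All (InRange n) (map (L ∘ ρ-edge) es)) (sym length-eq) (All-resp-↭ (↭-sym labels-perm) in-range)
      ; proper = All.tabulate proper-es
      ; covered = λ u u<sm → subst (_∈ vals) (sym (weight-ρ u (≤-pred u<sm)))
                                    (covered (ρ u) (s≤s (rot-bounded c d c+d≡m u (≤-pred u<sm))))
      }
      where
      open GoodWeighting gw
      es : List Edge
      es = removeAt W e

      es-perm : map ρ-edge es ↭ R₀
      es-perm = drop-∷ (↭-trans (↭-sym (subst (λ z → map ρ-edge W ↭ z ∷ map ρ-edge es) ρe≡e₀ (map⁺ ρ-edge (lookup-↭ W e))))
                                 (↭-trans ρ-permutes-edges W↭))

      labels-perm : map (L ∘ ρ-edge) es ↭ map L R₀
      labels-perm = subst (_↭ map L R₀) (sym (map-∘ es)) (map⁺ L es-perm)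

      length-eq : length es ≡ length R₀
      length-eq = trans (sym (length-map ρ-edge es)) (↭-length es-perm)

      es-bounded : All VerticesBounded es
      es-bounded with All-resp-↭ (lookup-↭ W e) W-bounded
      ... | _ ∷ bounded = bounded

      weight-ρ : ∀ u → u ≤ m → weightAt (L ∘ ρ-edge) es u ≡ weightAt L R₀ (ρ u)
      weight-ρ u u≤m = trans (weight-map es es-bounded) (weightAt-↭ L (ρ u) es-perm)
        where
        weight-map : ∀ xs → All VerticesBounded xs → weightAt (L ∘ ρ-edge) xs u ≡ weightAt L (map ρ-edge xs) (ρ u)
        weight-map [] [] = refl
        weight-map (ed ∷ xs) (b ∷ bs) =
          cong₂ _+_ (cong (λ t → if t then L (ρ-edge ed) else 0) (incident-ρ ed u≤m b)) (weight-map xs bs)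

      proper-es : ∀ {ed} → ed ∈ es → weightAt (L ∘ ρ-edge) es (proj₁ ed) ≢ weightAt (L ∘ ρ-edge) es (proj₂ ed)
      proper-es {a , b} ed∈ with All.lookup es-bounded ed∈
      ... | a≤m , b≤m rewrite weight-ρ a a≤m | weight-ρ b b≤m = All.lookup proper (∈-resp-↭ es-perm (∈-map⁺ ρ-edge ed∈))

  spokeRemoved : List Edge
  spokeRemoved = map rimEdge (upTo m) ++ map spoke (applyUpTo suc m')

  rimRemoved : List Edge
  rimRemoved = map rimEdge (applyUpTo suc m') ++ map spoke (upTo m)

  spokeRemoved-perm : W ↭ spoke 0 ∷ spokeRemoved
  spokeRemoved-perm = shift (spoke 0) (map rimEdge (upTo m)) (map spoke (applyUpTo suc m'))

  rimRemoved-perm : W ↭ rimEdge 0 ∷ rimRemoved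
  rimRemoved-perm = ↭-refl

  prev : ℕ → ℕ
  prev zero = m'
  prev (suc w) = w

  prev<m : ∀ {w} → w < m → prev w < m
  prev<m {zero} _ = ≤-refl
  prev<m {suc w} w<m = <-trans (n<1+n w) w<m

  next-prev : ∀ {w} → w < m → next (prev w) ≡ w
  next-prev {zero} _ = next-last
  next-prev {suc w} w<m = next-step w<m

  next≡⇒prev : ∀ {w i} → i < m → next i ≡ w → i ≡ prev w
  next≡⇒prev {w} {i} i<m next-i≡w with next-view i i<m
  next≡⇒prev {zero} _ next-i≡w | step _ next-i≡si with () ← trans (sym next-i≡si) next-i≡w
  next≡⇒prev {suc w} _ next-i≡w | step _ next-i≡si = suc-injective (trans (sym next-i≡si) next-i≡w)
  next≡⇒prev {zero} _ _ | wrap si≡m _ = suc-injective si≡m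
  next≡⇒prev {suc w} _ next-i≡w | wrap _ next-i≡0 with () ← trans (sym next-i≡0) next-i≡w

  split : (ℕ → ℕ) → (ℕ → ℕ) → Edge → ℕ
  split R S (a , b) = if b ≡ᵇ m then S a else R a

  split-rim : ∀ R S i → split R S (rimEdge i) ≡ R i
  split-rim R S i = if-false (≡ᵇ-false (<⇒≢ (next<m i)))

  split-spoke : ∀ R S i → split R S (spoke i) ≡ S i
  split-spoke R S i = if-true (≡ᵇ-refl m)

  labels-block : ∀ (L : Edge → ℕ) (h : ℕ → Edge) (g f : ℕ → ℕ) k → (∀ i → L (h i) ≡ g i) → map L (map h (applyUpTo f k)) ≡ applyUpTo (g ∘ f) k
  labels-block L h g f k L∘h≡g =
    trans (sym (map-∘ (applyUpTo f k))) (trans (map-applyUpTo f (L ∘ h) k) (applyUpTo-cong _ _ k (λ i _ → L∘h≡g (f i))))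

  labels-spokeRemoved : ∀ R S → map (split R S) spokeRemoved ≡ applyUpTo R m ++ applyUpTo (S ∘ suc) m'
  labels-spokeRemoved R S = trans (map-++ (split R S) (map rimEdge (upTo m)) (map spoke (applyUpTo suc m')))
    (cong₂ _++_ (labels-block (split R S) rimEdge R id m (split-rim R S)) (labels-block (split R S) spoke S suc m' (split-spoke R S)))

  labels-rimRemoved : ∀ R S → map (split R S) rimRemoved ≡ applyUpTo (R ∘ suc) m' ++ applyUpTo S m
  labels-rimRemoved R S = trans (map-++ (split R S) (map rimEdge (applyUpTo suc m')) (map spoke (upTo m)))
    (cong₂ _++_ (labels-block (split R S) rimEdge R suc m' (split-rim R S)) (labels-block (split R S) spoke S id m (split-spoke R S)))

  length-block : ∀ (h : ℕ → Edge) f k → length (map h (applyUpTo f k)) ≡ k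
  length-block h f k = trans (length-map h (applyUpTo f k)) (length-applyUpTo f k)

  length-spokeRemoved : length spokeRemoved ≡ m + m'
  length-spokeRemoved = trans (length-++ (map rimEdge (upTo m))) (cong₂ _+_ (length-block rimEdge id m) (length-block spoke suc m'))

  length-rimRemoved : length rimRemoved ≡ m' + m
  length-rimRemoved = trans (length-++ (map rimEdge (applyUpTo suc m'))) (cong₂ _+_ (length-block rimEdge suc m') (length-block spoke id m))

  -- the removed edge carries weight 0 in the weightings used for W − e₀
  weightAt-spokeRemoved : ∀ R S → S 0 ≡ 0 → ∀ u → weightAt (split R S) spokeRemoved u ≡ weightAt (split R S) W u
  weightAt-spokeRemoved R S S0≡0 u =
    sym (trans (weightAt-↭ (split R S) u spokeRemoved-perm) (weightAt-∷-zero (split R S) spokeRemoved u (trans (split-spoke R S 0) S0≡0)))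

  weightAt-rimRemoved : ∀ R S → R 0 ≡ 0 → ∀ u → weightAt (split R S) rimRemoved u ≡ weightAt (split R S) W u
  weightAt-rimRemoved R S R0≡0 u = sym (weightAt-∷-zero (split R S) rimRemoved u (trans (split-rim R S 0) R0≡0))

  weightAt-block : ∀ (L : Edge → ℕ) (h : ℕ → Edge) u → weightAt L (map h (upTo m)) u ≡ sumTo (λ i → if incident u (h i) then L (h i) else 0) m
  weightAt-block L h u = cong sum (trans (sym (map-∘ (upTo m))) (map-applyUpTo id _ m))

  weightAt-rims : ∀ R S u → weightAt (split R S) (map rimEdge (upTo m)) u ≡ sumTo (λ i → if incident u (rimEdge i) then R i else 0) m
  weightAt-rims R S u = trans (weightAt-block (split R S) rimEdge u)
                              (sumTo-cong _ _ m (λ i _ → cong (λ x → if incident u (rimEdge i) then x else 0) (split-rim R S i)))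

  weightAt-spokes : ∀ R S u → weightAt (split R S) (map spoke (upTo m)) u ≡ sumTo (λ i → if incident u (spoke i) then S i else 0) m
  weightAt-spokes R S u = trans (weightAt-block (split R S) spoke u)
                                (sumTo-cong _ _ m (λ i _ → cong (λ x → if incident u (spoke i) then x else 0) (split-spoke R S i)))

  weightAt-hub : ∀ R S → weightAt (split R S) W m ≡ sumTo S m
  weightAt-hub R S = trans (weightAt-++ (split R S) (map rimEdge (upTo m)) (map spoke (upTo m)) m)
    (cong₂ _+_ (trans (weightAt-rims R S m) (sumTo-zero (λ i → if incident m (rimEdge i) then R i else 0) m (λ i i<m → if-false (no-rim i i<m))))
               (trans (weightAt-spokes R S m) (sumTo-cong (λ i → if incident m (spoke i) then S i else 0) S m (λ i _ → if-true (trans (cong ((m ≡ᵇ i) ∨_) (≡ᵇ-refl m)) (∨-zeroʳ _))))))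
    where
    no-rim : ∀ i → i < m → incident m (rimEdge i) ≡ false
    no-rim i i<m = cong₂ _∨_ (≡ᵇ-false (<⇒≢ i<m ∘ sym)) (≡ᵇ-false (<⇒≢ (next<m i) ∘ sym))

  module RimVertices (1≤m' : 1 ≤ m') where

    -- with at least two rim vertices no rim edge is a loop
    next≢self : ∀ i → i < m → next i ≢ i
    next≢self i i<m next-i≡i with next-view i i<m
    ... | step _ next-i≡si = 1+n≢n (trans (sym next-i≡si) next-i≡i)
    ... | wrap si≡m next-i≡0 = 1+n≰n (subst (1 ≤_) (trans (sym (suc-injective si≡m)) (trans (sym next-i≡i) next-i≡0)) 1≤m')

    if-∨ : ∀ p q (x : ℕ) → (p ≡ true → q ≡ true → ⊥) → (if p ∨ q then x else 0) ≡ (if p then x else 0) + (if q then x else 0)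
    if-∨ true true x not-both = ⊥-elim (not-both refl refl)
    if-∨ true false x _ = sym (+-identityʳ x)
    if-∨ false true x _ = refl
    if-∨ false false x _ = refl

    rim-sum : ∀ (R : ℕ → ℕ) w → w < m → sumTo (λ i → if incident w (rimEdge i) then R i else 0) m ≡ R w + R (prev w)
    rim-sum R w w<m =
      trans (sumTo-cong (λ i → if incident w (rimEdge i) then R i else 0) (λ i → as-start i + as-end i) m (λ i i<m → if-∨ (w ≡ᵇ i) (w ≡ᵇ next i) (R i) (not-both i i<m)))
      (trans (sumTo-+ as-start as-end m)
      (cong₂ _+_ (trans (sumTo-single as-start m w w<m (λ i _ i≢w → if-false (≡ᵇ-false (i≢w ∘ sym)))) (if-true (≡ᵇ-refl w)))
                 (trans (sumTo-single as-end m (prev w) (prev<m w<m) (λ i i<m i≢ → if-false (≡ᵇ-false (i≢ ∘ next≡⇒prev {w} i<m ∘ sym))))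
                        (if-true (trans (cong (w ≡ᵇ_) (next-prev w<m)) (≡ᵇ-refl w))))))
      where
      as-start as-end : ℕ → ℕ
      as-start i = if w ≡ᵇ i then R i else 0
      as-end i = if w ≡ᵇ next i then R i else 0
      not-both : ∀ i → i < m → (w ≡ᵇ i) ≡ true → (w ≡ᵇ next i) ≡ true → ⊥
      not-both i i<m w≡i w≡next-i = next≢self i i<m (trans (sym (≡ᵇ-sound w (next i) w≡next-i)) (≡ᵇ-sound w i w≡i))

    spoke-sum : ∀ (S : ℕ → ℕ) w → w < m → sumTo (λ i → if incident w (spoke i) then S i else 0) m ≡ S w
    spoke-sum S w w<m =
      trans (sumTo-single (λ i → if incident w (spoke i) then S i else 0) m w w<m (λ i _ i≢w → if-false (trans (cong ((w ≡ᵇ i) ∨_) (≡ᵇ-false (<⇒≢ w<m))) (trans (∨-identityʳ _) (≡ᵇ-false (i≢w ∘ sym))))))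
            (if-true (cong (_∨ (w ≡ᵇ m)) (≡ᵇ-refl w)))

    weightAt-rim : ∀ R S w → w < m → weightAt (split R S) W w ≡ R w + R (prev w) + S w
    weightAt-rim R S w w<m = trans (weightAt-++ (split R S) (map rimEdge (upTo m)) (map spoke (upTo m)) w)
      (cong₂ _+_ (trans (weightAt-rims R S w) (rim-sum R w w<m)) (trans (weightAt-spokes R S w) (spoke-sum S w w<m)))

  colouring : (ℕ → ℕ) → ℕ → ℕ → ℕ
  colouring F h w = if w <ᵇ m then F w else h

  colouring-rim : ∀ F h {w} → w < m → colouring F h w ≡ F w
  colouring-rim F h w<m = if-true (<ᵇ-true w<m)

  colouring-hub : ∀ F h → colouring F h m ≡ h
  colouring-hub F h = if-false (<ᵇ-false {m} {m} ≤-refl)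

  ProperFor : (ℕ → ℕ) → Edge → Set
  ProperFor C (a , b) = C a ≢ C b

  proper-rimEdge : ∀ F h i → i < m → F i ≢ F (next i) → ProperFor (colouring F h) (rimEdge i)
  proper-rimEdge F h i i<m Fi≢ e = Fi≢ (trans (sym (colouring-rim F h i<m)) (trans e (colouring-rim F h (next<m i))))

  proper-spoke : ∀ F h i → i < m → F i ≢ h → ProperFor (colouring F h) (spoke i)
  proper-spoke F h i i<m Fi≢h e = Fi≢h (trans (sym (colouring-rim F h i<m)) (trans e (colouring-hub F h)))

  proper-spokeRemoved : ∀ F h → (∀ i → i < m → F i ≢ F (next i)) → (∀ i → i < m → F i ≢ h) →
                        All (ProperFor (colouring F h)) spokeRemoved
  proper-spokeRemoved F h rim-ok hub-ok =
    AllP.++⁺ (All-block rimEdge id m (λ i i<m → proper-rimEdge F h i i<m (rim-ok i i<m)))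
             (All-block spoke suc m' (λ i i<m' → proper-spoke F h (suc i) (s≤s i<m') (hub-ok (suc i) (s≤s i<m'))))

  proper-rimRemoved : ∀ F h → (∀ i → i < m' → F (suc i) ≢ F (next (suc i))) → (∀ i → i < m → F i ≢ h) →
                      All (ProperFor (colouring F h)) rimRemoved
  proper-rimRemoved F h rim-ok hub-ok =
    AllP.++⁺ (All-block rimEdge suc m' (λ i i<m' → proper-rimEdge F h (suc i) (s≤s i<m') (rim-ok i i<m')))
             (All-block spoke id m (λ i i<m → proper-spoke F h i i<m (hub-ok i i<m)))

  assemble : ∀ {e₀ R₀} → W ↭ e₀ ∷ R₀ → (L : Edge → ℕ) (F : ℕ → ℕ) (h : ℕ) (vals : List ℕ) →
             Unique (map L R₀) → All (InRange (length R₀)) (map L R₀) →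
             (∀ w → w < m → weightAt L R₀ w ≡ F w) → weightAt L R₀ m ≡ h → All (ProperFor (colouring F h)) R₀ →
             (∀ w → w < m → F w ∈ vals) → h ∈ vals → GoodWeighting (suc m) R₀ vals
  assemble {e₀} {R₀} W↭ L F h vals distinct in-range rim-weight hub-weight proper-C F∈vals h∈vals = record
    { L = L
    ; distinct = distinct
    ; in-range = in-range
    ; proper = All.zipWith proper-edge (R₀-bounded , proper-C)
    ; covered = λ w w<sm → subst (_∈ vals) (sym (weight≡colour (≤-pred w<sm))) (colour∈vals (≤-pred w<sm))
    }
    where
    R₀-bounded : All VerticesBounded R₀
    R₀-bounded with All-resp-↭ W↭ W-bounded
    ... | _ ∷ bounded = bounded
    weight≡colour : ∀ {w} → w ≤ m → weightAt L R₀ w ≡ colouring F h w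
    weight≡colour w≤m with m≤n⇒m<n∨m≡n w≤m
    ... | inj₁ w<m = trans (rim-weight _ w<m) (sym (colouring-rim F h w<m))
    ... | inj₂ refl = trans hub-weight (sym (colouring-hub F h))
    colour∈vals : ∀ {w} → w ≤ m → colouring F h w ∈ vals
    colour∈vals w≤m with m≤n⇒m<n∨m≡n w≤m
    ... | inj₁ w<m = subst (_∈ vals) (sym (colouring-rim F h w<m)) (F∈vals _ w<m)
    ... | inj₂ refl = subst (_∈ vals) (sym (colouring-hub F h)) h∈vals
    proper-edge : ∀ {ed} → VerticesBounded ed × ProperFor (colouring F h) ed → weightAt L R₀ (proj₁ ed) ≢ weightAt L R₀ (proj₂ ed)
    proper-edge {a , b} ((a≤m , b≤m) , Ca≢Cb) e = Ca≢Cb (trans (sym (weight≡colour a≤m)) (trans e (weight≡colour b≤m)))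

  LabelingWith : Fin (length W) → ℕ → Set
  LabelingWith e k = ∃[ f ] (IsLocalAntimagic (wheelMinus m e) f × colours (wheelMinus m e) f ≤ k)

  minus-spoke : (e : Fin (length W)) {v : ℕ} → v < m → lookup W e ≡ spoke v →
                {vals : List ℕ} → GoodWeighting (suc m) spokeRemoved vals → LabelingWith e (length vals)
  minus-spoke e {v} v<m removed {vals} gw =
    weighting⇒labeling (wheelMinus m e) vals
      (transport e (trans (cong ρ-edge removed) (cong₂ _,_ ρ-c ρ-hub))
                   spokeRemoved-perm gw)
    where
    open Rotation v v<m

  minus-rim : (e : Fin (length W)) {j : ℕ} → j < m → lookup W e ≡ rimEdge j →
              {vals : List ℕ} → GoodWeighting (suc m) rimRemoved vals → LabelingWith e (length vals)
  minus-rim e {j} j<m removed {vals} gw =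
    weighting⇒labeling (wheelMinus m e) vals
      (transport e (trans (cong ρ-edge removed) (cong₂ _,_ ρ-c (trans (ρ-next j j<m) (cong next ρ-c)))) rimRemoved-perm gw)
    where
    open Rotation j j<m

data EvenOdd : ℕ → Set where
  even : ∀ t → EvenOdd (t * 2)
  odd : ∀ t → EvenOdd (suc (t * 2))

evenOdd : ∀ k → EvenOdd k
evenOdd zero = even 0
evenOdd (suc k) with evenOdd k
... | even t = odd t
... | odd t = even (suc t)

byParity : (ℕ → ℕ) → (ℕ → ℕ) → ℕ → ℕ
byParity e o zero = e 0
byParity e o (suc zero) = o 0
byParity e o (suc (suc k)) = byParity (e ∘ suc) (o ∘ suc) k

byParity-even : ∀ e o t → byParity e o (t * 2) ≡ e t
byParity-even e o zero = refl
byParity-even e o (suc t) = byParity-even (e ∘ suc) (o ∘ suc) t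

byParity-odd : ∀ e o t → byParity e o (suc (t * 2)) ≡ o t
byParity-odd e o zero = refl
byParity-odd e o (suc t) = byParity-odd (e ∘ suc) (o ∘ suc) t

*2≢suc*2 : ∀ t u → t * 2 ≢ suc (u * 2)
*2≢suc*2 zero u ()
*2≢suc*2 (suc t) zero e = 1+n≢0 (suc-injective e)
*2≢suc*2 (suc t) (suc u) e = *2≢suc*2 t u (suc-injective (suc-injective e))

half<-even : ∀ t {k} → t * 2 < k * 2 → t < k
half<-even t = *-cancelʳ-< 2 t _

half<-odd : ∀ t {k} → suc (t * 2) < k * 2 → t < k
half<-odd t p = half<-even t (<-trans (n<1+n _) p)

two-blocks : ∀ (f g : ℕ → ℕ) k l {a N} →
             (∀ i j → i < k → j < k → f i ≡ f j → i ≡ j) → (∀ i → i < k → InRange a (f i)) →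
             (∀ i j → i < l → j < l → g i ≡ g j → i ≡ j) → (∀ i → i < l → a < g i × g i ≤ N) → a ≤ N →
             Unique (applyUpTo f k ++ applyUpTo g l) × All (InRange N) (applyUpTo f k ++ applyUpTo g l)
two-blocks f g k l {a} {N} f-inj f-range g-inj g-range a≤N =
  Unique.++⁺ (distinct f k f-inj) (distinct g l g-inj) disjoint ,
  AllP.++⁺ (All.tabulate (λ x∈ → let (i , i<k , x≡) = ∈-applyUpTo⁻ f x∈ ; (1≤ , ≤a) = f-range i i<k
                                  in subst (InRange N) (sym x≡) (1≤ , ≤-trans ≤a a≤N)))
           (All.tabulate (λ x∈ → let (j , j<l , x≡) = ∈-applyUpTo⁻ g x∈ ; (a< , ≤N) = g-range j j<l
                                  in subst (InRange N) (sym x≡) (≤-trans (s≤s z≤n) a< , ≤N)))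
  where
  distinct : ∀ h n → (∀ i j → i < n → j < n → h i ≡ h j → i ≡ j) → Unique (applyUpTo h n)
  distinct h n inj = Unique.applyUpTo⁺₁ h n (λ {i} {j} i<j j<n e → <-irrefl (inj i j (<-trans i<j j<n) j<n e) i<j)
  disjoint : ∀ {x} → ¬ (x ∈ applyUpTo f k × x ∈ applyUpTo g l)
  disjoint (x∈f , x∈g) with ∈-applyUpTo⁻ f x∈f | ∈-applyUpTo⁻ g x∈g
  ... | i , i<k , refl | j , j<l , fi≡gj = <-irrefl fi≡gj (≤-<-trans (proj₂ (f-range i i<k)) (proj₁ (g-range j j<l)))

<-by-witness : ∀ {a b} d → b ≡ a + suc d → a < b
<-by-witness {a} d b≡ = subst (a <_) (sym b≡) (subst (a <_) (sym (+-suc a d)) (s≤s (m≤m+n a d)))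

x≤K : ∀ {x a K} → x + a ≡ K → x ≤ K
x≤K {x} {a} x+a≡K = subst (x ≤_) x+a≡K (m≤m+n x a)

c≤x : ∀ {x a K} c → x + a ≡ K → c + a ≤ K → c ≤ x
c≤x {x} {a} c x+a≡K c+a≤K = +-cancelʳ-≤ a c x (subst (c + a ≤_) (sym x+a≡K) c+a≤K)

substitute : ∀ a {s c d} b → s + c ≡ d → a + d ≡ b + c → a + s ≡ b
substitute a {s} {c} {d} b s+c≡d a+d≡b+c =
  +-cancelʳ-≡ c (a + s) b (trans (+-assoc a s c) (trans (cong (a +_) s+c≡d) a+d≡b+c))

-- The rim labels of both constructions interleave two increasing runs:
-- interleave c lists 1, c + 1, 2, c + 2, 3, … .
interleave : ℕ → ℕ → ℕ
interleave c = byParity suc (λ t → c + suc t)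

module Interleave (c K : ℕ) (K≤2c : K ≤ c * 2) (2c≤1+K : c * 2 ≤ suc K) where

  even-half : ∀ t → t * 2 < K → t < c
  even-half t t*2<K = half<-even t (<-≤-trans t*2<K K≤2c)

  odd-value≤K : ∀ {t} → suc (t * 2) < K → c + suc t ≤ K
  odd-value≤K {t} 2t+2≤K =
    halve (c + suc t) K (subst₂ _≤_ (sum-eq c t) (bound-eq K) (+-mono-≤ 2c≤1+K 2t+2≤K))
    where
    sum-eq : ∀ c t → c * 2 + suc t * 2 ≡ (c + suc t) * 2
    sum-eq = solve-∀
    bound-eq : ∀ K → suc K + K ≡ suc (K * 2)
    bound-eq = solve-∀
    halve : ∀ x K → x * 2 ≤ suc (K * 2) → x ≤ K
    halve zero K _ = z≤n
    halve (suc x) zero (s≤s ())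
    halve (suc x) (suc K) (s≤s (s≤s x*2≤)) = s≤s (halve x K x*2≤)

  runs-apart : ∀ {t u} → t < c → suc t ≢ c + suc u
  runs-apart {t} {u} t<c e = <-irrefl e (≤-<-trans t<c (m<m+n c (s≤s z≤n)))

  injective : ∀ i j → i < K → j < K → interleave c i ≡ interleave c j → i ≡ j
  injective i j i<K j<K e with evenOdd i | evenOdd j
  ... | even t | even u = cong (_* 2) (suc-injective (trans (sym (byParity-even _ _ t)) (trans e (byParity-even _ _ u))))
  ... | odd t | odd u = cong (λ s → suc (s * 2))
          (suc-injective (+-cancelˡ-≡ c _ _ (trans (sym (byParity-odd _ _ t)) (trans e (byParity-odd _ _ u)))))
  ... | even t | odd u = ⊥-elim (runs-apart (even-half t i<K) (trans (sym (byParity-even _ _ t)) (trans e (byParity-odd _ _ u))))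
  ... | odd t | even u = ⊥-elim (runs-apart (even-half u j<K) (trans (sym (byParity-even _ _ u)) (trans (sym e) (byParity-odd _ _ t))))

  in-range : ∀ i → i < K → InRange K (interleave c i)
  in-range i i<K with evenOdd i
  ... | even t = subst (InRange K) (sym (byParity-even _ _ t)) (s≤s z≤n , ≤-<-trans (m≤m*n t 2) i<K)
  ... | odd t = subst (InRange K) (sym (byParity-odd _ _ t)) (≤-trans (s≤s z≤n) (m≤n+m (suc t) c) , odd-value≤K i<K)

-- The spoke labels shared by both constructions (m = 2n + 1): spoke k + 1 gets topLabel n k,
-- so the spokes 1, 3, 5, … get 4n, 4n − 2, … and the spokes 2, 4, 6, … get 4n + 1, 4n − 1, … .
topLabel : ℕ → ℕ → ℕ
topLabel n = byParity (λ t → n * 4 ∸ t * 2) (λ t → n * 4 + 1 ∸ t * 2)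

module TopLabel (n : ℕ) where

  t*2≤n*4 : ∀ {t} → t < n → t * 2 ≤ n * 4
  t*2≤n*4 {t} t<n = ≤-trans (*-monoˡ-≤ 2 (<⇒≤ t<n)) (*-monoʳ-≤ n (s≤s (s≤s z≤n)))

  even-eq : ∀ t → t < n → topLabel n (t * 2) + t * 2 ≡ n * 4
  even-eq t t<n = trans (cong (_+ t * 2) (byParity-even _ _ t)) (m∸n+n≡m (t*2≤n*4 t<n))

  odd-eq : ∀ t → t < n → topLabel n (suc (t * 2)) + t * 2 ≡ n * 4 + 1
  odd-eq t t<n = trans (cong (_+ t * 2) (byParity-odd _ _ t)) (m∸n+n≡m (≤-trans (t*2≤n*4 t<n) (m≤m+n (n * 4) 1)))

  parities : ∀ x t u → x + t * 2 ≡ n * 4 → x + u * 2 ≡ n * 4 + 1 → ⊥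
  parities x t u p q = *2≢suc*2 u t (+-cancelˡ-≡ x _ _ (trans q (trans (cong (_+ 1) (sym p)) (shuffle x t))))
    where
    shuffle : ∀ x t → x + t * 2 + 1 ≡ x + suc (t * 2)
    shuffle = solve-∀

  low : ∀ {t} → t < n → n * 2 + 2 + t * 2 ≤ n * 4
  low {t} t<n = subst₂ _≤_ (sym (rearrange n t)) (double n) (+-monoʳ-≤ (n * 2) (*-monoˡ-≤ 2 t<n))
    where
    rearrange : ∀ n t → n * 2 + 2 + t * 2 ≡ n * 2 + suc t * 2
    rearrange = solve-∀
    double : ∀ n → n * 2 + n * 2 ≡ n * 4
    double = solve-∀

  injective : ∀ i j → i < n * 2 → j < n * 2 → topLabel n i ≡ topLabel n j → i ≡ j
  injective i j i< j< e with evenOdd i | evenOdd j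
  ... | even t | even u = cong (_* 2) (*-cancelʳ-≡ t u 2 (+-cancelˡ-≡ (topLabel n (t * 2)) _ _
          (trans (even-eq t (half<-even t i<)) (sym (trans (cong (_+ u * 2) e) (even-eq u (half<-even u j<)))))))
  ... | odd t | odd u = cong (λ s → suc (s * 2)) (*-cancelʳ-≡ t u 2 (+-cancelˡ-≡ (topLabel n (suc (t * 2))) _ _
          (trans (odd-eq t (half<-odd t i<)) (sym (trans (cong (_+ u * 2) e) (odd-eq u (half<-odd u j<)))))))
  ... | even t | odd u = ⊥-elim (parities (topLabel n (t * 2)) t u (even-eq t (half<-even t i<)) (trans (cong (_+ u * 2) e) (odd-eq u (half<-odd u j<))))
  ... | odd t | even u = ⊥-elim (parities (topLabel n (u * 2)) u t (even-eq u (half<-even u j<)) (trans (cong (_+ t * 2) (sym e)) (odd-eq t (half<-odd t i<))))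

  bounds : ∀ k → k < n * 2 → n * 2 + 2 ≤ topLabel n k × topLabel n k ≤ n * 4 + 1
  bounds k k< with evenOdd k
  ... | even t = c≤x (n * 2 + 2) (even-eq t t<n) (low t<n) , ≤-trans (x≤K (even-eq t t<n)) (m≤m+n (n * 4) 1)
    where
    t<n : t < n
    t<n = half<-even t k<
  ... | odd t = c≤x (n * 2 + 2) (odd-eq t t<n) (≤-trans (low t<n) (m≤m+n (n * 4) 1)) , x≤K (odd-eq t t<n)
    where
    t<n : t < n
    t<n = half<-odd t k<

  above-2n+1 : ∀ k → k < n * 2 → suc (n * 2) < topLabel n k
  above-2n+1 k k< = subst (_≤ topLabel n k) (+-comm (n * 2) 2) (proj₁ (bounds k k<))

-- The rim edge i
-- gets interleave (n + 1) i (that is 1, n + 2, 2, n + 3, …), the missing spoke 0 weight 0 and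
-- the spoke k + 1 the label topLabel n k.  Then vertex 0 has weight n + 2, the odd rim
-- vertices 5n + 3, the even ones 5n + 5, and the hub a much larger weight.
module SpokeConstruction (n : ℕ) (2≤n : 2 ≤ n) where

  open Wheel (n * 2)

  1≤n : 1 ≤ n
  1≤n = ≤-trans (s≤s z≤n) 2≤n

  open RimVertices (≤-trans 1≤n (m≤m*n n 2))

  rimLabel : ℕ → ℕ
  rimLabel = interleave (suc n)

  spokeLabel : ℕ → ℕ
  spokeLabel zero = 0
  spokeLabel (suc k) = topLabel n k

  rimColour : ℕ → ℕ
  rimColour zero = n + 2
  rimColour (suc k) = byParity (const (n * 5 + 3)) (const (n * 5 + 5)) k

  hubColour : ℕ
  hubColour = sumTo spokeLabel m

  palette : List ℕ
  palette = n + 2 ∷ n * 5 + 3 ∷ n * 5 + 5 ∷ hubColour ∷ []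

  label-even : ∀ t → rimLabel (t * 2) ≡ suc t
  label-even = byParity-even suc (λ t → suc n + suc t)

  label-odd : ∀ t → rimLabel (suc (t * 2)) ≡ suc n + suc t
  label-odd = byParity-odd suc (λ t → suc n + suc t)

  colour-odd : ∀ t → rimColour (suc (t * 2)) ≡ n * 5 + 3
  colour-odd = byParity-even (const (n * 5 + 3)) (const (n * 5 + 5))

  colour-even : ∀ t → rimColour (suc t * 2) ≡ n * 5 + 5
  colour-even = byParity-odd (const (n * 5 + 3)) (const (n * 5 + 5))

  weight-0 : rimLabel 0 + rimLabel (prev 0) + spokeLabel 0 ≡ rimColour 0
  weight-0 = trans (cong (λ x → 1 + x + 0) (label-even n)) (arith n)
    where
    arith : ∀ n → 1 + suc n + 0 ≡ n + 2
    arith = solve-∀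

  weight-odd : ∀ t → t < n → rimLabel (suc (t * 2)) + rimLabel (t * 2) + spokeLabel (suc (t * 2)) ≡ rimColour (suc (t * 2))
  weight-odd t t<n = begin
    rimLabel (suc (t * 2)) + rimLabel (t * 2) + topLabel n (t * 2)
      ≡⟨ cong₂ (λ a b → a + b + topLabel n (t * 2)) (label-odd t) (label-even t) ⟩
    suc n + suc t + suc t + topLabel n (t * 2)
      ≡⟨ substitute (suc n + suc t + suc t) (n * 5 + 3) (TopLabel.even-eq n t t<n) (arith n t) ⟩
    n * 5 + 3
      ≡⟨ sym (colour-odd t) ⟩
    rimColour (suc (t * 2)) ∎
    where
    open ≡-Reasoning
    arith : ∀ n t → suc n + suc t + suc t + n * 4 ≡ n * 5 + 3 + t * 2
    arith = solve-∀

  weight-even : ∀ t → t < n → rimLabel (suc t * 2) + rimLabel (suc (t * 2)) + spokeLabel (suc t * 2) ≡ rimColour (suc t * 2)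
  weight-even t t<n = begin
    rimLabel (suc t * 2) + rimLabel (suc (t * 2)) + topLabel n (suc (t * 2))
      ≡⟨ cong₂ (λ a b → a + b + topLabel n (suc (t * 2))) (label-even (suc t)) (label-odd t) ⟩
    suc (suc t) + (suc n + suc t) + topLabel n (suc (t * 2))
      ≡⟨ substitute (suc (suc t) + (suc n + suc t)) (n * 5 + 5) (TopLabel.odd-eq n t t<n) (arith n t) ⟩
    n * 5 + 5
      ≡⟨ sym (colour-even t) ⟩
    rimColour (suc t * 2) ∎
    where
    open ≡-Reasoning
    arith : ∀ n t → suc (suc t) + (suc n + suc t) + (n * 4 + 1) ≡ n * 5 + 5 + t * 2
    arith = solve-∀

  rim-weight : ∀ w → w < m → weightAt (split rimLabel spokeLabel) spokeRemoved w ≡ rimColour w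
  rim-weight w w<m =
    trans (weightAt-spokeRemoved rimLabel spokeLabel refl w) (trans (weightAt-rim rimLabel spokeLabel w w<m) (by-vertex w w<m))
    where
    by-vertex : ∀ w → w < m → rimLabel w + rimLabel (prev w) + spokeLabel w ≡ rimColour w
    by-vertex zero _ = weight-0
    by-vertex (suc k) (s≤s k<2n) with evenOdd k
    ... | even t = weight-odd t (half<-even t k<2n)
    ... | odd t = weight-even t (half<-odd t k<2n)

  hub-weight : weightAt (split rimLabel spokeLabel) spokeRemoved m ≡ hubColour
  hub-weight = trans (weightAt-spokeRemoved rimLabel spokeLabel refl m) (weightAt-hub rimLabel spokeLabel)

  3≢5 : n * 5 + 3 ≢ n * 5 + 5
  3≢5 e = <-irrefl e (+-monoʳ-< (n * 5) (s≤s (s≤s (s≤s (s≤s z≤n)))))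

  n+2<5n+3 : n + 2 < n * 5 + 3
  n+2<5n+3 = <-by-witness (n * 4) (arith n)
    where
    arith : ∀ n → n * 5 + 3 ≡ n + 2 + suc (n * 4)
    arith = solve-∀

  consecutive : ∀ i → rimColour i ≢ rimColour (suc i)
  consecutive zero e = <-irrefl e n+2<5n+3
  consecutive (suc k) with evenOdd k
  ... | even t = λ e → 3≢5 (trans (sym (colour-odd t)) (trans e (colour-even t)))
  ... | odd t = λ e → 3≢5 (trans (sym (colour-odd (suc t))) (trans (sym e) (colour-even t)))

  last-colour : rimColour (n * 2) ≡ n * 5 + 5
  last-colour = trans (cong (λ z → rimColour (z * 2)) (sym (m+[n∸m]≡n 1≤n))) (colour-even (n ∸ 1))

  rim-proper : ∀ i → i < m → rimColour i ≢ rimColour (next i)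
  rim-proper i i<m with next-view i i<m
  ... | step _ next≡ = subst (λ j → rimColour i ≢ rimColour j) (sym next≡) (consecutive i)
  ... | wrap si≡m next≡0 = subst (λ j → rimColour i ≢ rimColour j) (sym next≡0) λ e →
          <-irrefl (trans (sym e) (trans (cong rimColour (suc-injective si≡m)) last-colour)) (<-trans n+2<5n+3 (+-monoʳ-< (n * 5) (s≤s (s≤s (s≤s (s≤s z≤n))))))

  rimColour≤ : ∀ w → rimColour w ≤ n * 5 + 5
  rimColour≤ zero = ≤-trans (<⇒≤ n+2<5n+3) (+-monoʳ-≤ (n * 5) (s≤s (s≤s (s≤s z≤n))))
  rimColour≤ (suc k) with evenOdd k
  ... | even t = subst (_≤ n * 5 + 5) (sym (colour-odd t)) (+-monoʳ-≤ (n * 5) (s≤s (s≤s (s≤s z≤n))))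
  ... | odd t = ≤-reflexive (colour-even t)

  hub-large : n * 5 + 5 < hubColour
  hub-large = <-≤-trans (quadratic n 2≤n) (sumTo-lower (topLabel n) (n * 2) (n * 2 + 2) (λ k k< → proj₁ (TopLabel.bounds n k k<)))
    where
    quadratic : ∀ n → 2 ≤ n → n * 5 + 5 < n * 2 * (n * 2 + 2)
    quadratic (suc zero) (s≤s ())
    quadratic (suc (suc k)) _ = <-by-witness (8 + k * 15 + k * k * 4) (arith k)
      where
      arith : ∀ k → (2 + k) * 2 * ((2 + k) * 2 + 2) ≡ (2 + k) * 5 + 5 + suc (8 + k * 15 + k * k * 4)
      arith = solve-∀

  rimColour∈ : ∀ w → w < m → rimColour w ∈ palette
  rimColour∈ zero _ = here refl
  rimColour∈ (suc k) _ with evenOdd k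
  ... | even t = subst (_∈ palette) (sym (colour-odd t)) (there (here refl))
  ... | odd t = subst (_∈ palette) (sym (colour-even t)) (there (there (here refl)))

  -- the labels are 1, …, 4n + 1: rim labels in [1, 2n + 1], spoke labels in [2n + 2, 4n + 1]
  labels : Unique (applyUpTo rimLabel m ++ applyUpTo (topLabel n) (n * 2)) × All (InRange (n * 4 + 1)) (applyUpTo rimLabel m ++ applyUpTo (topLabel n) (n * 2))
  labels = two-blocks rimLabel (topLabel n) m (n * 2) (Interleave.injective (suc n) m (n≤1+n m) ≤-refl) (Interleave.in-range (suc n) m (n≤1+n m) ≤-refl)
                      (TopLabel.injective n) (λ k k< → TopLabel.above-2n+1 n k k< , proj₂ (TopLabel.bounds n k k<))
                      (subst (m ≤_) (arith n) (m≤m+n m (n * 2)))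
    where
    arith : ∀ n → suc (n * 2) + n * 2 ≡ n * 4 + 1
    arith = solve-∀

  goodWeighting : GoodWeighting (suc m) spokeRemoved palette
  goodWeighting = assemble spokeRemoved-perm (split rimLabel spokeLabel) rimColour hubColour palette
    (subst Unique (sym (labels-spokeRemoved rimLabel spokeLabel)) (proj₁ labels))
    (subst₂ (λ N xs → All (InRange N) xs) (sym (trans length-spokeRemoved (arith n))) (sym (labels-spokeRemoved rimLabel spokeLabel)) (proj₂ labels))
    rim-weight hub-weight
    (proper-spokeRemoved rimColour hubColour rim-proper (λ i _ e → <-irrefl e (≤-<-trans (rimColour≤ i) hub-large)))
    rimColour∈ (there (there (there (here refl))))
    where
    arith : ∀ n → suc (n * 2) + n * 2 ≡ n * 4 + 1
    arith = solve-∀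

-- The missing
-- rim edge 0 gets weight 0, the rim edge k + 1 the label interleave n k (1, n + 1, 2, n + 2, …),
-- the spoke 0 the label 2n + 1 and the spoke k + 1 the label topLabel n k.  Then vertices 0 and 1
-- have weight 4n + 1, the odd rim vertices ≥ 3 weight 5n + 1, the even ones ≥ 2 weight 5n + 3.
module RimConstruction (n : ℕ) (1≤n : 1 ≤ n) where

  open Wheel (n * 2)
  open RimVertices (≤-trans 1≤n (m≤m*n n 2))

  rimLabel : ℕ → ℕ
  rimLabel zero = 0
  rimLabel (suc k) = interleave n k

  spokeLabel : ℕ → ℕ
  spokeLabel zero = suc (n * 2)
  spokeLabel (suc k) = topLabel n k

  oddColour : ℕ → ℕ
  oddColour zero = n * 4 + 1
  oddColour (suc _) = n * 5 + 1

  rimColour : ℕ → ℕ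
  rimColour zero = n * 4 + 1
  rimColour (suc k) = byParity oddColour (const (n * 5 + 3)) k

  hubColour : ℕ
  hubColour = sumTo spokeLabel m

  palette : List ℕ
  palette = n * 4 + 1 ∷ n * 5 + 1 ∷ n * 5 + 3 ∷ hubColour ∷ []

  label-even : ∀ t → rimLabel (suc (t * 2)) ≡ suc t
  label-even = byParity-even suc (λ t → n + suc t)

  label-odd : ∀ t → rimLabel (suc t * 2) ≡ n + suc t
  label-odd = byParity-odd suc (λ t → n + suc t)

  colour-odd : ∀ t → rimColour (suc (t * 2)) ≡ oddColour t
  colour-odd = byParity-even oddColour (const (n * 5 + 3))

  colour-even : ∀ t → rimColour (suc t * 2) ≡ n * 5 + 3
  colour-even = byParity-odd oddColour (const (n * 5 + 3))

  n≡suc : n ≡ suc (n ∸ 1)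
  n≡suc = sym (m+[n∸m]≡n 1≤n)

  weight-0 : rimLabel 0 + rimLabel (prev 0) + spokeLabel 0 ≡ rimColour 0
  weight-0 = trans (cong (λ x → x + suc (n * 2)) last-label) (arith n)
    where
    last-label : rimLabel (n * 2) ≡ n + n
    last-label = trans (cong (λ z → rimLabel (z * 2)) n≡suc) (trans (label-odd (n ∸ 1)) (cong (n +_) (sym n≡suc)))
    arith : ∀ n → n + n + suc (n * 2) ≡ n * 4 + 1
    arith = solve-∀

  weight-1 : rimLabel 1 + rimLabel 0 + spokeLabel 1 ≡ rimColour 1
  weight-1 = arith n
    where
    arith : ∀ n → 1 + 0 + n * 4 ≡ n * 4 + 1
    arith = solve-∀

  weight-odd : ∀ t → suc t < n → rimLabel (suc (suc t * 2)) + rimLabel (suc t * 2) + spokeLabel (suc (suc t * 2)) ≡ rimColour (suc (suc t * 2))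
  weight-odd t st<n = begin
    rimLabel (suc (suc t * 2)) + rimLabel (suc t * 2) + topLabel n (suc t * 2)
      ≡⟨ cong₂ (λ a b → a + b + topLabel n (suc t * 2)) (label-even (suc t)) (label-odd t) ⟩
    suc (suc t) + (n + suc t) + topLabel n (suc t * 2)
      ≡⟨ substitute (suc (suc t) + (n + suc t)) (n * 5 + 1) (TopLabel.even-eq n (suc t) st<n) (arith n t) ⟩
    n * 5 + 1
      ≡⟨ sym (colour-odd (suc t)) ⟩
    rimColour (suc (suc t * 2)) ∎
    where
    open ≡-Reasoning
    arith : ∀ n t → suc (suc t) + (n + suc t) + n * 4 ≡ n * 5 + 1 + suc t * 2
    arith = solve-∀

  weight-even : ∀ t → t < n → rimLabel (suc t * 2) + rimLabel (suc (t * 2)) + spokeLabel (suc t * 2) ≡ rimColour (suc t * 2)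
  weight-even t t<n = begin
    rimLabel (suc t * 2) + rimLabel (suc (t * 2)) + topLabel n (suc (t * 2))
      ≡⟨ cong₂ (λ a b → a + b + topLabel n (suc (t * 2))) (label-odd t) (label-even t) ⟩
    n + suc t + suc t + topLabel n (suc (t * 2))
      ≡⟨ substitute (n + suc t + suc t) (n * 5 + 3) (TopLabel.odd-eq n t t<n) (arith n t) ⟩
    n * 5 + 3
      ≡⟨ sym (colour-even t) ⟩
    rimColour (suc t * 2) ∎
    where
    open ≡-Reasoning
    arith : ∀ n t → n + suc t + suc t + (n * 4 + 1) ≡ n * 5 + 3 + t * 2
    arith = solve-∀

  rim-weight : ∀ w → w < m → weightAt (split rimLabel spokeLabel) rimRemoved w ≡ rimColour w
  rim-weight w w<m =
    trans (weightAt-rimRemoved rimLabel spokeLabel refl w) (trans (weightAt-rim rimLabel spokeLabel w w<m) (by-vertex w w<m))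
    where
    by-vertex : ∀ w → w < m → rimLabel w + rimLabel (prev w) + spokeLabel w ≡ rimColour w
    by-vertex zero _ = weight-0
    by-vertex (suc k) (s≤s k<2n) with evenOdd k
    ... | even zero = weight-1
    ... | even (suc t) = weight-odd t (half<-even (suc t) k<2n)
    ... | odd t = weight-even t (half<-odd t k<2n)

  hub-weight : weightAt (split rimLabel spokeLabel) rimRemoved m ≡ hubColour
  hub-weight = trans (weightAt-rimRemoved rimLabel spokeLabel refl m) (weightAt-hub rimLabel spokeLabel)

  4n+1<5n+3 : n * 4 + 1 < n * 5 + 3
  4n+1<5n+3 = <-by-witness (n + 1) (arith n)
    where
    arith : ∀ n → n * 5 + 3 ≡ n * 4 + 1 + suc (n + 1)
    arith = solve-∀

  5n+1<5n+3 : n * 5 + 1 < n * 5 + 3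
  5n+1<5n+3 = +-monoʳ-< (n * 5) (s≤s (s≤s z≤n))

  oddColour<5n+3 : ∀ t → oddColour t < n * 5 + 3
  oddColour<5n+3 zero = 4n+1<5n+3
  oddColour<5n+3 (suc _) = 5n+1<5n+3

  consecutive : ∀ j → rimColour (suc j) ≢ rimColour (suc (suc j))
  consecutive j with evenOdd j
  ... | even t = λ e → <-irrefl (trans (sym (colour-odd t)) (trans e (colour-even t))) (oddColour<5n+3 t)
  ... | odd t = λ e → <-irrefl (trans (sym (colour-odd (suc t))) (trans (sym e) (colour-even t))) 5n+1<5n+3

  last-colour : rimColour (n * 2) ≡ n * 5 + 3
  last-colour = trans (cong (λ z → rimColour (z * 2)) n≡suc) (colour-even (n ∸ 1))

  rim-proper : ∀ j → j < n * 2 → rimColour (suc j) ≢ rimColour (next (suc j))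
  rim-proper j j< with next-view (suc j) (s≤s j<)
  ... | step _ next≡ = subst (λ i → rimColour (suc j) ≢ rimColour i) (sym next≡) (consecutive j)
  ... | wrap ssj≡m next≡0 = subst (λ i → rimColour (suc j) ≢ rimColour i) (sym next≡0) λ e →
          <-irrefl (trans (sym e) (trans (cong rimColour (suc-injective ssj≡m)) last-colour)) 4n+1<5n+3

  rimColour≤ : ∀ w → rimColour w ≤ n * 5 + 3
  rimColour≤ zero = <⇒≤ 4n+1<5n+3
  rimColour≤ (suc k) with evenOdd k
  ... | even t = subst (_≤ n * 5 + 3) (sym (colour-odd t)) (<⇒≤ (oddColour<5n+3 t))
  ... | odd t = ≤-reflexive (colour-even t)

  spokeLabel-low : ∀ k → k < m → suc (n * 2) ≤ spokeLabel k
  spokeLabel-low zero _ = ≤-refl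
  spokeLabel-low (suc k) (s≤s k<) = <⇒≤ (TopLabel.above-2n+1 n k k<)

  hub-large : n * 5 + 3 < hubColour
  hub-large = <-≤-trans (quadratic n 1≤n) (sumTo-lower spokeLabel m (suc (n * 2)) spokeLabel-low)
    where
    quadratic : ∀ n → 1 ≤ n → n * 5 + 3 < suc (n * 2) * suc (n * 2)
    quadratic (suc k) _ = <-by-witness (k * k * 4 + k * 7) (arith k)
      where
      arith : ∀ k → suc (suc k * 2) * suc (suc k * 2) ≡ suc k * 5 + 3 + suc (k * k * 4 + k * 7)
      arith = solve-∀

  rimColour∈ : ∀ w → w < m → rimColour w ∈ palette
  rimColour∈ zero _ = here refl
  rimColour∈ (suc k) _ with evenOdd k
  ... | even zero = subst (_∈ palette) (sym (colour-odd 0)) (here refl)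
  ... | even (suc t) = subst (_∈ palette) (sym (colour-odd (suc t))) (there (here refl))
  ... | odd t = subst (_∈ palette) (sym (colour-even t)) (there (there (here refl)))

  -- the labels are 1, …, 4n + 1: rim labels in [1, 2n], spoke labels in [2n + 1, 4n + 1]
  spokeLabel-injective : ∀ i j → i < m → j < m → spokeLabel i ≡ spokeLabel j → i ≡ j
  spokeLabel-injective zero zero _ _ _ = refl
  spokeLabel-injective zero (suc j) _ (s≤s j<) e = ⊥-elim (<-irrefl e (TopLabel.above-2n+1 n j j<))
  spokeLabel-injective (suc i) zero (s≤s i<) _ e = ⊥-elim (<-irrefl (sym e) (TopLabel.above-2n+1 n i i<))
  spokeLabel-injective (suc i) (suc j) (s≤s i<) (s≤s j<) e = cong suc (TopLabel.injective n i j i< j< e)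

  spokeLabel-range : ∀ k → k < m → n * 2 < spokeLabel k × spokeLabel k ≤ n * 4 + 1
  spokeLabel-range zero _ = ≤-refl , subst (suc (n * 2) ≤_) (arith n) (m≤m+n (suc (n * 2)) (n * 2))
    where
    arith : ∀ n → suc (n * 2) + n * 2 ≡ n * 4 + 1
    arith = solve-∀
  spokeLabel-range (suc k) (s≤s k<) = <-trans (n<1+n _) (TopLabel.above-2n+1 n k k<) , proj₂ (TopLabel.bounds n k k<)

  labels : Unique (applyUpTo (interleave n) (n * 2) ++ applyUpTo spokeLabel m) ×
           All (InRange (n * 4 + 1)) (applyUpTo (interleave n) (n * 2) ++ applyUpTo spokeLabel m)
  labels = two-blocks (interleave n) spokeLabel (n * 2) m
             (Interleave.injective n (n * 2) ≤-refl (n≤1+n _)) (Interleave.in-range n (n * 2) ≤-refl (n≤1+n _))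
             spokeLabel-injective spokeLabel-range (≤-trans (*-monoʳ-≤ n (s≤s (s≤s z≤n))) (m≤m+n (n * 4) 1))

  goodWeighting : GoodWeighting (suc m) rimRemoved palette
  goodWeighting = assemble rimRemoved-perm (split rimLabel spokeLabel) rimColour hubColour palette
    (subst Unique (sym (labels-rimRemoved rimLabel spokeLabel)) (proj₁ labels))
    (subst₂ (λ N xs → All (InRange N) xs) (sym (trans length-rimRemoved (arith n))) (sym (labels-rimRemoved rimLabel spokeLabel)) (proj₂ labels))
    rim-weight hub-weight
    (proper-rimRemoved rimColour hubColour rim-proper (λ i _ e → <-irrefl e (≤-<-trans (rimColour≤ i) hub-large)))
    rimColour∈ (there (there (there (here refl))))
    where
    arith : ∀ n → n * 2 + suc (n * 2) ≡ n * 4 + 1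
    arith = solve-∀

-- Small wheels.  For m = 3, 5, 7 a good weighting with three colours of W_m − spoke is given
-- by explicit tables of rim and spoke labels and checked by evaluation.
nth : List ℕ → ℕ → ℕ
nth [] _ = 0
nth (x ∷ xs) zero = x
nth (x ∷ xs) (suc i) = nth xs i

module Tabulated (m' : ℕ) (rims spokes vals : List ℕ) where

  open Wheel m'

  L : Edge → ℕ
  L = split (nth rims) (nth spokes)

  checked : True (unique? (map L spokeRemoved)) →
            True (all? (λ x → (1 ≤? x) ×-dec (x ≤? length spokeRemoved)) (map L spokeRemoved)) →
            True (all? (λ ed → ¬? (weightAt L spokeRemoved (proj₁ ed) ≟ weightAt L spokeRemoved (proj₂ ed))) spokeRemoved) →
            True (all? (λ w → weightAt L spokeRemoved w ∈? vals) (upTo (suc m))) →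
            GoodWeighting (suc m) spokeRemoved vals
  checked distinct in-range proper covered = record
    { L = L
    ; distinct = toWitness distinct
    ; in-range = toWitness in-range
    ; proper = toWitness proper
    ; covered = λ w w< → All.lookup (toWitness covered) (∈-upTo⁺ w<)
    }

small-3 : GoodWeighting 4 (Wheel.spokeRemoved 2) (6 ∷ 8 ∷ 10 ∷ [])
small-3 = Tabulated.checked 2 (1 ∷ 3 ∷ 5 ∷ []) (0 ∷ 4 ∷ 2 ∷ []) (6 ∷ 8 ∷ 10 ∷ []) tt tt tt tt

small-5 : GoodWeighting 6 (Wheel.spokeRemoved 4) (12 ∷ 14 ∷ 19 ∷ [])
small-5 = Tabulated.checked 4 (4 ∷ 9 ∷ 7 ∷ 5 ∷ 8 ∷ []) (0 ∷ 1 ∷ 3 ∷ 2 ∷ 6 ∷ []) (12 ∷ 14 ∷ 19 ∷ []) tt tt tt tt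

small-7 : GoodWeighting 8 (Wheel.spokeRemoved 6) (21 ∷ 23 ∷ 25 ∷ [])
small-7 = Tabulated.checked 6 (12 ∷ 4 ∷ 11 ∷ 7 ∷ 10 ∷ 9 ∷ 13 ∷ []) (0 ∷ 5 ∷ 8 ∷ 3 ∷ 6 ∷ 2 ∷ 1 ∷ []) (21 ∷ 23 ∷ 25 ∷ []) tt tt tt tt

triangular : ℕ → ℕ
triangular zero = zero
triangular (suc d) = suc d + triangular d

triangular-mono : ∀ {a b} → a ≤ b → triangular a ≤ triangular b
triangular-mono z≤n = z≤n
triangular-mono (s≤s a≤b) = +-mono-≤ (s≤s a≤b) (triangular-mono a≤b)

sum-distinct-lower : ∀ B xs → Unique xs → All (InRange B) xs → length xs ≤ B × triangular (length xs) ≤ sum xs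
sum-distinct-lower zero [] _ _ = z≤n , z≤n
sum-distinct-lower zero (x ∷ xs) _ ((1≤x , x≤0) ∷ _) = ⊥-elim (1+n≰n (≤-trans 1≤x x≤0))
sum-distinct-lower (suc B) xs u inRange with suc B ∈? xs
... | no B∉xs =
  let (len≤ , tri≤) = sum-distinct-lower B xs u (shrink inRange (All.tabulate (λ x∈ e → B∉xs (subst (_∈ xs) e x∈))))
  in m≤n⇒m≤1+n len≤ , tri≤
  where
  shrink : ∀ {ys} → All (InRange (suc B)) ys → All (_≢ suc B) ys → All (InRange B) ys
  shrink r n = All.zipWith (λ ((1≤x , x≤) , x≢) → 1≤x , ≤-pred (≤∧≢⇒< x≤ x≢)) (r , n)
sum-distinct-lower (suc B) xs u inRange | yes B∈xs with ∈-∃++ B∈xs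
... | as , bs , refl with Unique-resp-↭ (shift (suc B) as bs) u | All-resp-↭ (shift (suc B) as bs) inRange
...   | B∉rest ∷ u-rest | _ ∷ rest-inRange =
  subst (_≤ suc B) (sym len-eq) (s≤s len≤) ,
  subst (λ l → triangular l ≤ sum xs') (sym len-eq) (subst (triangular (suc (length rest)) ≤_) (sym sum-eq) (+-mono-≤ (s≤s len≤) tri≤))
  where
  xs' rest : List ℕ
  xs' = as ++ suc B ∷ bs
  rest = as ++ bs
  len-eq : length xs' ≡ suc (length rest)
  len-eq = ↭-length (shift (suc B) as bs)
  sum-eq : sum xs' ≡ suc B + sum rest
  sum-eq = sum-↭ (shift (suc B) as bs)
  rest-below : All (InRange B) rest
  rest-below = All.zipWith (λ ((1≤x , x≤) , B≢x) → 1≤x , ≤-pred (≤∧≢⇒< x≤ (B≢x ∘ sym))) (rest-inRange , B∉rest)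
  len≤ : length rest ≤ B
  len≤ = proj₁ (sum-distinct-lower B rest u-rest rest-below)
  tri≤ : triangular (length rest) ≤ sum rest
  tri≤ = proj₂ (sum-distinct-lower B rest u-rest rest-below)

sum-two-distinct : ∀ N xs → Unique xs → length xs ≤ 2 → All (_≤ N) xs → 1 ≤ N → suc (sum xs) ≤ N + N
sum-two-distinct N [] _ _ _ 1≤N = ≤-trans 1≤N (m≤m+n N N)
sum-two-distinct N (a ∷ []) _ _ (a≤N ∷ []) 1≤N =
  subst (_≤ N + N) (cong suc (sym (+-identityʳ a))) (subst (_≤ N + N) (+-comm a 1) (+-mono-≤ a≤N 1≤N))
sum-two-distinct N (a ∷ b ∷ []) ((a≢b ∷ []) ∷ _) _ (a≤N ∷ b≤N ∷ []) _ with <-cmp a b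
... | tri< a<b _ _ = subst (_≤ N + N) (cong (λ z → suc (a + z)) (sym (+-identityʳ b))) (+-mono-≤ (≤-trans a<b b≤N) b≤N)
... | tri≈ _ a≡b _ = ⊥-elim (a≢b a≡b)
... | tri> _ _ b<a = subst (_≤ N + N) (trans (+-suc a b) (cong (λ z → suc (a + z)) (sym (+-identityʳ b)))) (+-mono-≤ a≤N (≤-trans b<a a≤N))
sum-two-distinct N (a ∷ b ∷ c ∷ xs) _ (s≤s (s≤s ())) _ _

triangular-closed : ∀ d → triangular d * 2 ≡ d * suc d
triangular-closed zero = refl
triangular-closed (suc d) =
  trans (*-distribʳ-+ 2 (suc d) (triangular d)) (trans (cong (suc d * 2 +_) (triangular-closed d)) (arith d))
  where
  arith : ∀ d → suc d * 2 + d * suc d ≡ suc d * suc (suc d)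
  arith = solve-∀

module LowerBounds (m' : ℕ) (2≤m' : 2 ≤ m') where

  open Wheel m'

  1<m : 1 < m
  1<m = s≤s (≤-trans (s≤s z≤n) 2≤m')

  next-0 : next 0 ≡ 1
  next-0 = next-step 1<m

  next-1 : next 1 ≡ 2
  next-1 = next-step (s≤s 2≤m')

  other-than : ∀ j → ∃[ i ] (i < m × i ≢ j)
  other-than zero = 1 , 1<m , λ ()
  other-than (suc j) = 0 , s≤s z≤n , λ ()

  avoiding : ∀ v → ∃[ i ] (i < m × i ≢ v × next i ≢ v)
  avoiding zero = 1 , 1<m , (λ ()) , (λ e′ → 2≢0 (trans (sym next-1) e′))
    where
    2≢0 : 2 ≢ 0
    2≢0 ()
  avoiding (suc zero) = m' , ≤-refl , (λ m'≡1 → <-irrefl (sym m'≡1) 2≤m') , (λ e′ → 0≢1 (trans (sym next-last) e′))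
    where
    0≢1 : 0 ≢ 1
    0≢1 ()
  avoiding (suc (suc v)) = 0 , s≤s z≤n , (λ ()) , (λ e′ → 1≢ (trans (sym next-0) e′))
    where
    1≢ : 1 ≢ suc (suc v)
    1≢ ()

  module Minus (e : Fin (length W)) where

    G : Graph
    G = wheelMinus m e

    removed : Edge
    removed = lookup W e

    kept : ∀ {ed} → ed ∈ W → ed ≢ removed → ed ∈ edges G
    kept ed∈ ed≢ with ∈-resp-↭ (lookup-↭ W e) ed∈
    ... | here ed≡ = ⊥-elim (ed≢ ed≡)
    ... | there ed∈G = ed∈G

    size-G : size G ≡ m' + m
    size-G = trans (length-removeAt W e)
                   (cong pred (trans (length-++ (map rimEdge (upTo m))) (cong₂ _+_ (length-block rimEdge id m) (length-block spoke id m))))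

    module _ (f : Labeling G) (antimagic : IsLocalAntimagic G f) where

      open LabelingFacts G f

      fp : ℕ → ℕ
      fp = fplus G f

      adjacent : ∀ {ed} → ed ∈ W → ed ≢ removed → fp (proj₁ ed) ≢ fp (proj₂ ed)
      adjacent ed∈ ed≢ = adjacent-distinct antimagic (kept ed∈ ed≢)

      value≤ : ∀ {u} → u ≤ m → fp u ∈ values
      value≤ u≤m = value∈ (s≤s u≤m)

      triangle : ∀ i → i < m → rimEdge i ≢ removed → spoke i ≢ removed → spoke (next i) ≢ removed → 3 ≤ colours G f
      triangle i i<m rim-kept spoke-kept next-kept =
        colours-≥ (fp i ∷ fp (next i) ∷ fp m ∷ [])
                  ((adjacent (rimEdge∈W i<m) rim-kept ∷ adjacent (spoke∈W i<m) spoke-kept ∷ []) ∷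
                   (adjacent (spoke∈W (next<m i)) next-kept ∷ []) ∷ [] ∷ [])
                  (value≤ (<⇒≤ i<m) ∷ value≤ (<⇒≤ (next<m i)) ∷ value≤ ≤-refl ∷ [])

      three-colours : 3 ≤ colours G f
      three-colours with edge-view (∈-lookup e)
      ... | inj₁ (j , _ , removed≡) =
        let (i , i<m , i≢j) = other-than j in
        triangle i i<m (λ e′ → i≢j (cong proj₁ (trans e′ removed≡))) (spoke≢ i) (spoke≢ (next i))
        where
        spoke≢ : ∀ x → spoke x ≢ removed
        spoke≢ x e′ = rimEdge≢spoke j x (sym (trans e′ removed≡))
      ... | inj₂ (v , _ , removed≡) =
        let (i , i<m , i≢v , next-i≢v) = avoiding v in
        triangle i i<m (λ e′ → rimEdge≢spoke i v (trans e′ removed≡)) (spoke≢ i≢v) (spoke≢ next-i≢v)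
        where
        spoke≢ : ∀ {x} → x ≢ v → spoke x ≢ removed
        spoke≢ x≢v e′ = x≢v (cong proj₁ (trans e′ removed≡))

      module SpokeRemoved (v : ℕ) (v<m : v < m) (removed≡ : removed ≡ spoke v) where

        hub : ℕ
        hub = fp m

        rim-adjacent : ∀ i → i < m → fp i ≢ fp (next i)
        rim-adjacent i i<m = adjacent (rimEdge∈W i<m) (λ e′ → rimEdge≢spoke i v (trans e′ removed≡))

        spoke-adjacent : ∀ u → u < m → u ≢ v → fp u ≢ hub
        spoke-adjacent u u<m u≢v = adjacent (spoke∈W u<m) (λ e′ → u≢v (cong proj₁ (trans e′ removed≡)))

        count-removed : ∀ p → p removed ≡ true → count p W ≡ suc (count p (edges G))
        count-removed p p-removed = trans (count-↭ p (lookup-↭ W e)) (if-true p-removed)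

        hub-degree : m' ≤ count (incident m) (edges G)
        hub-degree = ≤-pred (subst (m ≤_) (count-removed (incident m) hub-on-removed)
                       (subst (m ≤_) (sym (count-++ (incident m) (map rimEdge (upTo m)) (map spoke (upTo m))))
                         (≤-trans (≤-reflexive (sym all-spokes)) (m≤n+m _ _))))
          where
          hub-on-removed : incident m removed ≡ true
          hub-on-removed = subst (λ ed → incident m ed ≡ true) (sym removed≡) (trans (cong ((m ≡ᵇ v) ∨_) (≡ᵇ-refl m)) (∨-zeroʳ _))
          all-spokes : count (incident m) (map spoke (upTo m)) ≡ m
          all-spokes = trans (count-map (incident m) spoke (upTo m))
                       (trans (count-all (incident m ∘ spoke) (upTo m) (All.tabulate (λ {x} _ → trans (cong ((m ≡ᵇ x) ∨_) (≡ᵇ-refl m)) (∨-zeroʳ _))))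
                              (length-applyUpTo id m))

        v-degree : count (incident v) (edges G) ≤ 2
        v-degree = ≤-pred (subst (_≤ 3) (count-removed (incident v) v-on-removed)
                     (subst (_≤ 3) (sym (count-++ (incident v) (map rimEdge (upTo m)) (map spoke (upTo m))))
                       (+-mono-≤ rim-edges-at-v spokes-at-v)))
          where
          v-on-removed : incident v removed ≡ true
          v-on-removed = subst (λ ed → incident v ed ≡ true) (sym removed≡) (cong (_∨ (v ≡ᵇ m)) (≡ᵇ-refl v))
          only-v : count (v ≡ᵇ_) (upTo m) ≤ 1
          only-v = count-unique≤1 (v ≡ᵇ_) (upTo m) v (Unique.upTo⁺ m) (λ _ v≡x → sym (≡ᵇ-sound v _ v≡x))
          rim-edges-at-v : count (incident v) (map rimEdge (upTo m)) ≤ 2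
          rim-edges-at-v = subst (_≤ 2) (sym (count-map (incident v) rimEdge (upTo m)))
            (≤-trans (count-∨ (v ≡ᵇ_) (λ i → v ≡ᵇ next i) (upTo m))
              (+-mono-≤ only-v (count-unique≤1 (λ i → v ≡ᵇ next i) (upTo m) (prev v) (Unique.upTo⁺ m)
                                  (λ x∈ v≡next → next≡⇒prev {v} (∈-upTo⁻ x∈) (sym (≡ᵇ-sound v _ v≡next))))))
          spokes-at-v : count (incident v) (map spoke (upTo m)) ≤ 1
          spokes-at-v = subst (_≤ 1) (sym (count-map (incident v) spoke (upTo m)))
            (≤-trans (count-mono (incident v ∘ spoke) (v ≡ᵇ_) (upTo m)
                       (λ x inc → trans (sym (∨-identityʳ (v ≡ᵇ x))) (trans (cong ((v ≡ᵇ x) ∨_) (sym (≡ᵇ-false (<⇒≢ v<m)))) inc)))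
                     only-v)

        -- Counting: the hub weight is at least 1 + ⋯ + m', the weight of v less than 2 |E(G)|.
        counting : 8 ≤ m' → fp v ≢ hub
        counting 8≤m' fpv≡hub =
          <-irrefl refl (<-≤-trans (subst (_< N + N) fpv≡hub v-small) (≤-trans (subst (λ x → x + x ≤ triangular m') (sym size-G) (bound m' 8≤m')) hub-large))
          where
          N : ℕ
          N = size G
          hub-large : triangular m' ≤ hub
          hub-large = ≤-trans (triangular-mono (subst (m' ≤_) (sym (length-incidentLabels m)) hub-degree))
                        (subst (triangular (length (incidentLabels m)) ≤_) (sym (fplus≡sum m))
                          (proj₂ (sum-distinct-lower N (incidentLabels m) (incidentLabels-unique m) (incidentLabels-inRange m))))
          v-small : fp v < N + N
          v-small = subst (λ x → suc x ≤ N + N) (sym (fplus≡sum v))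
                      (sum-two-distinct N (incidentLabels v) (incidentLabels-unique v)
                        (subst (_≤ 2) (sym (length-incidentLabels v)) v-degree)
                        (All.map proj₂ (incidentLabels-inRange v)) (subst (1 ≤_) (sym size-G) (m≤n⇒m≤o+n m' (s≤s z≤n))))
          bound : ∀ d → 8 ≤ d → (d + suc d) + (d + suc d) ≤ triangular d
          bound d 8≤d with d ∸ 8 | m+[n∸m]≡n 8≤d
          ... | j | refl = *-cancelʳ-≤ _ _ 2
                (subst₂ _≤_ (sym (lhs j)) (trans (sym (rhs j)) (sym (triangular-closed (8 + j)))) (m≤m+n (68 + j * 8) (4 + j * 9 + j * j)))
            where
            lhs : ∀ j → (8 + j + suc (8 + j) + (8 + j + suc (8 + j))) * 2 ≡ 68 + j * 8
            lhs = solve-∀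
            rhs : ∀ j → (8 + j) * suc (8 + j) ≡ 68 + j * 8 + (4 + j * 9 + j * j)
            rhs = solve-∀

        -- Parity: if only three colours occur and v avoids the hub colour, the rim vertices
        -- alternate between the colours of 0 and 1, which is impossible on an odd cycle.
        odd-cycle : ∀ k → m' ≡ k * 2 → colours G f ≤ 3 → fp v ≢ hub → ⊥
        odd-cycle k m'≡2k ≤3 fpv≢hub = rim-adjacent m' ≤-refl (trans (cong fp m'≡2k) (trans (alternate k (≤-reflexive (sym m'≡2k))) (cong fp (sym next-last))))
          where
          α β : ℕ
          α = fp 0
          β = fp 1
          rim≢hub : ∀ u → u < m → fp u ≢ hub
          rim≢hub u u<m with u ≟ v
          ... | yes refl = fpv≢hub
          ... | no u≢v = spoke-adjacent u u<m u≢v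
          α≢β : α ≢ β
          α≢β α≡β = rim-adjacent 0 (s≤s z≤n) (trans α≡β (cong fp (sym next-0)))
          two-values : ∀ u → u < m → fp u ≡ α ⊎ fp u ≡ β
          two-values u u<m with fp u ≟ α | fp u ≟ β
          ... | yes ≡α | _ = inj₁ ≡α
          ... | no _ | yes ≡β = inj₂ ≡β
          ... | no ≢α | no ≢β = ⊥-elim (<-irrefl refl (≤-<-trans (colours-≥ (hub ∷ α ∷ β ∷ fp u ∷ []) distinct four-values) (s≤s ≤3)))
            where
            distinct : Unique (hub ∷ α ∷ β ∷ fp u ∷ [])
            distinct = (rim≢hub 0 (s≤s z≤n) ∘ sym ∷ rim≢hub 1 1<m ∘ sym ∷ rim≢hub u u<m ∘ sym ∷ [])
                     ∷ (α≢β ∷ ≢α ∘ sym ∷ []) ∷ (≢β ∘ sym ∷ []) ∷ [] ∷ []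
            four-values : All (_∈ values) (hub ∷ α ∷ β ∷ fp u ∷ [])
            four-values = value≤ ≤-refl ∷ value≤ z≤n ∷ value≤ (<⇒≤ 1<m) ∷ value≤ (<⇒≤ u<m) ∷ []
          alternate : ∀ t → t * 2 ≤ m' → fp (t * 2) ≡ α
          alternate zero _ = refl
          alternate (suc t) 2t+2≤m' = next-colour (two-values (suc (t * 2)) 2t+1<m) (two-values (suc t * 2) (s≤s 2t+2≤m'))
            where
            2t+1<m : suc (t * 2) < m
            2t+1<m = m≤n⇒m≤1+n 2t+2≤m'
            previous : fp (t * 2) ≡ α
            previous = alternate t (≤-trans (n≤1+n _) (≤-trans (n≤1+n _) 2t+2≤m'))
            next-colour : fp (suc (t * 2)) ≡ α ⊎ fp (suc (t * 2)) ≡ β → fp (suc t * 2) ≡ α ⊎ fp (suc t * 2) ≡ β → fp (suc t * 2) ≡ α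
            next-colour (inj₁ ≡α) _ = ⊥-elim (rim-adjacent (t * 2) (<-trans (n<1+n _) 2t+1<m)
                                 (trans previous (trans (sym ≡α) (cong fp (sym (next-step 2t+1<m))))))
            next-colour (inj₂ _) (inj₁ ≡α) = ≡α
            next-colour (inj₂ ≡β) (inj₂ ≡β′) = ⊥-elim (rim-adjacent (suc (t * 2)) 2t+1<m
                                          (trans ≡β (trans (sym ≡β′) (cong fp (sym (next-step (s≤s 2t+2≤m')))))))

        four-colours : ∀ k → m' ≡ k * 2 → 8 ≤ m' → 4 ≤ colours G f
        four-colours k m'≡2k 8≤m' with 4 ≤? colours G f
        ... | yes 4≤colours = 4≤colours
        ... | no 4≰colours with fp v ≟ hub
        ...   | yes fpv≡hub = ⊥-elim (counting 8≤m' fpv≡hub)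
        ...   | no fpv≢hub = ⊥-elim (odd-cycle k m'≡2k (≤-pred (≰⇒> 4≰colours)) fpv≢hub)

three-colour-labeling : ∀ k → 1 ≤ k → suc (k * 2) ≤ 7 → (e : Fin (length (Wheel.W (k * 2)))) {v : ℕ} → v < suc (k * 2) →
                        lookup (Wheel.W (k * 2)) e ≡ Wheel.spoke (k * 2) v → Wheel.LabelingWith (k * 2) e 3
three-colour-labeling 1 _ _ e v<m removed≡ = Wheel.minus-spoke 2 e v<m removed≡ small-3
three-colour-labeling 2 _ _ e v<m removed≡ = Wheel.minus-spoke 4 e v<m removed≡ small-5
three-colour-labeling 3 _ _ e v<m removed≡ = Wheel.minus-spoke 6 e v<m removed≡ small-7
three-colour-labeling (suc (suc (suc (suc _)))) _ (s≤s (s≤s (s≤s (s≤s (s≤s (s≤s (s≤s ()))))))) _ _ _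

exactly : ∀ {G K} → (∀ f → IsLocalAntimagic G f → K ≤ colours G f) →
          ∃[ f ] (IsLocalAntimagic G f × colours G f ≤ K) → ChiLaIs G K
exactly lower (f , antimagic , ≤K) = (f , antimagic , ≤-antisym ≤K (lower f antimagic)) , lower

mainTheorem5 : (m : ℕ) → 3 ≤ m → (∃[ k ] m ≡ suc (k * 2)) →
    ((e : Fin (length (wheelEdges m))) → ¬ IsRimEdge m e →
      (m ≤ 7 → ChiLaIs (wheelMinus m e) 3) × (9 ≤ m → ChiLaIs (wheelMinus m e) 4))
    × ((e : Fin (length (wheelEdges m))) → IsRimEdge m e →
      ChiLaBetween (wheelMinus m e) 3 4)
mainTheorem5 .(suc (k * 2)) 3≤m (k , refl) = spoke-removed , rim-removed
  where
  1≤k : 1 ≤ k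
  1≤k = *-cancelʳ-≤ 1 k 2 (≤-pred 3≤m)

  open Wheel (k * 2)
  open LowerBounds (k * 2) (*-monoˡ-≤ 2 1≤k)

  spoke-removed : (e : Fin (length W)) → ¬ IsRimEdge m e →
                  (m ≤ 7 → ChiLaIs (wheelMinus m e) 3) × (9 ≤ m → ChiLaIs (wheelMinus m e) 4)
  spoke-removed e not-rim with spoke-position e not-rim
  ... | v , v<m , removed≡ =
    (λ m≤7 → exactly {wheelMinus m e} (Minus.three-colours e) (three-colour-labeling k 1≤k m≤7 e v<m removed≡)) ,
    (λ 9≤m → exactly {wheelMinus m e} (λ f antimagic → Minus.SpokeRemoved.four-colours e f antimagic v v<m removed≡ k refl (≤-pred 9≤m))
                     (minus-spoke e v<m removed≡ (SpokeConstruction.goodWeighting k (4≤k 9≤m))))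
    where
    4≤k : 9 ≤ m → 2 ≤ k
    4≤k 9≤m = *-cancelʳ-≤ 2 k 2 (≤-trans (s≤s (s≤s (s≤s (s≤s z≤n)))) (≤-pred 9≤m))

  rim-removed : (e : Fin (length W)) → IsRimEdge m e → ChiLaBetween (wheelMinus m e) 3 4
  rim-removed e is-rim with rim-position e is-rim
  ... | j , j<m , removed≡ = minus-rim e j<m removed≡ (RimConstruction.goodWeighting k 1≤k) , Minus.three-colours e
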